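{- For every $k\ge1$, the counterexample graph $G_k$ has exactly $8$ perfect matchings. Of these, $4$ lie in $(S_1\cap S_3)\setminus(S_2\cup S_4)$ and $4$ lie in $(S_2\cap S_4)\setminus(S_1\cup S_3)$.
   Context: Chain of boxes $B_k$ ($k\ge1$): take a path $v_0,v_1,\dots,v_{2k-1}$; for each $i=0,\dots,k-1$ add two new vertices $a_i,b_i$ and edges $\{v_{2i},a_i\},\{a_i,b_i\},\{b_i,v_{2i+1}\}$; endpoints $v_0,v_{2k-1}$. Torpid mixing gadget $H_k$: take a 12-cycle $c_0c_1\cdots c_{11}c_0$, let $a=c_0$, $b=c_6$ and add the edge $\{a,b\}$. Let $u=c_3$, $v=c_9$, $w_1=c_2$, $w_2=c_4$, $z_1=c_{10}$, $z_2=c_8$. Add four copies of $B_k$ (with otherwise new, disjoint vertices), identifying their endpoints $(v_0,v_{2k-1})$ with $(w_1,a)$, $(a,z_1)$, $(w_2,b)$, $(b,z_2)$ respectively. Counterexample graph $G_k$: take a 12-cycle with vertices in cyclic order $t_1,u_1,v_1,t_2,u_2,v_2,t_3,u_3,v_3,t_4,u_4,v_4$. For each $i=1,\dots,4$, delete the edge $\{u_i,v_i\}$ and replace it by a copy $H_i$ of $H_k$, identifying the vertices $u,v$ of $H_i$ with $u_i,v_i$ (other vertices of the copies new and disjoint). Let $\Omega(G_k)$ be the set of perfect matchings and near-perfect matchings (matchings with exactly two unmatched vertices) of $G_k$. For $i\in\{1,\dots,4\}$, $S_i$ is the set of $M\in\Omega(G_k)$ such that the restriction of $M$ to $H_i$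 (i.e., $M\cap E(H_i)$, a matching of $H_i$) leaves exactly the two vertices $u_i$ and $v_i$ of $H_i$ unmatched; equivalently $u_i,v_i$ are each either holes of $M$ or matched outside $H_i$, and all other vertices of $H_i$ are matched within $H_i$. -}

module Defs where

open import Data.Nat using (ℕ; zero; suc; _*_; _∸_; _<?_)
open import Data.Fin using (Fin; toℕ; fromℕ<; #_)
open import Data.Fin.Subset using (Subset; _∈_)
open import Data.List using (List; []; _∷_; _++_; map; concatMap; upTo; allFin; length; lookup)
open import Data.List.Relation.Unary.Unique.Propositional using (Unique)
import Data.List.Membership.Propositional as LM
open import Data.Maybe using (Maybe; just; nothing)
open import Data.Product using (_×_; _,_; ∃-syntax; proj₁; proj₂)
open import Data.Sum using (_⊎_)
open import Relation.Nullary using (¬_; yes; no)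
open import Relation.Binary.PropositionalEquality using (_≡_)
open import Function.Bundles using (_⇔_)

HasExactly : {A : Set} → (A → Set) → ℕ → Set
HasExactly {A} P n =
  ∃[ xs ] (length xs ≡ n × Unique xs × (∀ a → (P a ⇔ a LM.∈ xs)))

-- Copies H_1..H_4 are indexed by i : Fin 4 (0 ↦ H_1).
--  top i          : t_{i+1}
--  cyc i j        : vertex c_j of the 12-cycle of H_{i+1};
--                   u_{i+1} = cyc i 3, v_{i+1} = cyc i 9 (identification)
--  pathInt i r j  : internal path vertex v_{j+1} (1 ≤ j+1 ≤ 2k-2) of the
--                   r-th chain copy B_k in H_{i+1}
--  boxA i r m, boxB i r m : the vertices a_m, b_m of that chain copy

data V (k : ℕ) : Set where
  top     : Fin 4 → V k
  cyc     : Fin 4 → Fin 12 → V k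
  pathInt : Fin 4 → Fin 4 → Fin (2 * k ∸ 2) → V k
  boxA    : Fin 4 → Fin 4 → Fin k → V k
  boxB    : Fin 4 → Fin 4 → Fin k → V k

uV vV : {k : ℕ} → Fin 4 → V k
uV i = cyc i (# 3)
vV i = cyc i (# 9)

-- endpoints (v_0 , v_{2k-1}) of the r-th chain: (w1,a),(a,z1),(w2,b),(b,z2)
-- with a=c0, b=c6, w1=c2, w2=c4, z1=c10, z2=c8
chainStart chainEnd : Fin 4 → Fin 12
chainStart Fin.zero = # 2
chainStart (Fin.suc Fin.zero) = # 0
chainStart (Fin.suc (Fin.suc Fin.zero)) = # 4
chainStart (Fin.suc (Fin.suc (Fin.suc Fin.zero))) = # 6
chainEnd Fin.zero = # 0
chainEnd (Fin.suc Fin.zero) = # 10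
chainEnd (Fin.suc (Fin.suc Fin.zero)) = # 6
chainEnd (Fin.suc (Fin.suc (Fin.suc Fin.zero))) = # 8

-- path vertex v_j (0 ≤ j ≤ 2k-1) of the r-th chain in H_{i+1}
pathV : (k : ℕ) → Fin 4 → Fin 4 → ℕ → V k
pathV k i r zero = cyc i (chainStart r)
pathV k i r (suc j) with j <? (2 * k ∸ 2)
... | yes lt = pathInt i r (fromℕ< lt)
... | no _   = cyc i (chainEnd r)

-- Edges: owner = just i if the edge belongs to H_{i+1}, nothing if it is
-- an edge of the outer 12-cycle of G_k.

record Edge (k : ℕ) : Set where
  constructor edge
  field
    owner : Maybe (Fin 4)
    end₁  : V k
    end₂  : V k
open Edge public

nextTop : Fin 4 → Fin 4
nextTop Fin.zero = # 1
nextTop (Fin.suc Fin.zero) = # 2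
nextTop (Fin.suc (Fin.suc Fin.zero)) = # 3
nextTop (Fin.suc (Fin.suc (Fin.suc Fin.zero))) = # 0

-- outer cycle t1 u1 v1 t2 u2 v2 ... with the edges u_i v_i deleted
outerEdges : (k : ℕ) → List (Edge k)
outerEdges k = concatMap
  (λ i → edge nothing (top i) (uV i) ∷ edge nothing (vV i) (top (nextTop i)) ∷ [])
  (allFin 4)

cycleEdges : (k : ℕ) → Fin 4 → List (Edge k)
cycleEdges k i =
  e (# 0) (# 1) ∷ e (# 1) (# 2) ∷ e (# 2) (# 3) ∷ e (# 3) (# 4) ∷
  e (# 4) (# 5) ∷ e (# 5) (# 6) ∷ e (# 6) (# 7) ∷ e (# 7) (# 8) ∷
  e (# 8) (# 9) ∷ e (# 9) (# 10) ∷ e (# 10) (# 11) ∷ e (# 11) (# 0) ∷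
  e (# 0) (# 6) ∷ []
  where
  e : Fin 12 → Fin 12 → Edge k
  e j j' = edge (just i) (cyc i j) (cyc i j')

chainEdges : (k : ℕ) → Fin 4 → Fin 4 → List (Edge k)
chainEdges k i r =
  map (λ j → edge (just i) (pathV k i r j) (pathV k i r (suc j))) (upTo (2 * k ∸ 1))
  ++ concatMap
       (λ m → edge (just i) (pathV k i r (2 * toℕ m)) (boxA i r m)
            ∷ edge (just i) (boxA i r m) (boxB i r m)
            ∷ edge (just i) (boxB i r m) (pathV k i r (suc (2 * toℕ m)))
            ∷ [])
       (allFin k)

HEdges : (k : ℕ) → Fin 4 → List (Edge k)
HEdges k i = cycleEdges k i ++ concatMap (chainEdges k i) (allFin 4)

edges : (k : ℕ) → List (Edge k)
edges k = outerEdges k ++ concatMap (HEdges k) (allFin 4)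

nE : ℕ → ℕ
nE k = length (edges k)

-- an edge set of G_k = a subset of the edge positions in `edges k`
EdgeSet : ℕ → Set
EdgeSet k = Subset (nE k)

edgeAt : (k : ℕ) → Fin (nE k) → Edge k
edgeAt k e = lookup (edges k) e

Incident : {k : ℕ} → V k → Edge k → Set
Incident x ed = end₁ ed ≡ x ⊎ end₂ ed ≡ x

IsMatching : (k : ℕ) → EdgeSet k → Set
IsMatching k M = ∀ e e' → e ∈ M → e' ∈ M → ¬ (e ≡ e') →
  ∀ x → Incident x (edgeAt k e) → ¬ Incident x (edgeAt k e')

IsPerfectMatching : (k : ℕ) → EdgeSet k → Set
IsPerfectMatching k M =
  IsMatching k M × (∀ x → ∃[ e ] (e ∈ M × Incident x (edgeAt k e)))

-- S_{i+1}: M ∩ E(H_{i+1}) leaves exactly u_{i+1}, v_{i+1} unmatched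
-- among the vertices of H_{i+1}.

InH : {k : ℕ} → Fin 4 → V k → Set
InH i (top _) = Data.Empty.⊥ where import Data.Empty
InH i (cyc i' _) = i' ≡ i
InH i (pathInt i' _ _) = i' ≡ i
InH i (boxA i' _ _) = i' ≡ i
InH i (boxB i' _ _) = i' ≡ i

CoveredInH : (k : ℕ) → Fin 4 → EdgeSet k → V k → Set
CoveredInH k i M x =
  ∃[ e ] (e ∈ M × owner (edgeAt k e) ≡ just i × Incident x (edgeAt k e))

S : (k : ℕ) → Fin 4 → EdgeSet k → Set
S k i M = ∀ x → InH i x →
  ((x ≡ uV i ⊎ x ≡ vV i) → ¬ CoveredInH k i M x)
  × (¬ (x ≡ uV i ⊎ x ≡ vV i) → CoveredInH k i M x)

-- In a perfect matching of G_k a chain B_k that is entered at one end by a chain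
-- edge must also be left at its other end by a chain edge (the boxes propagate the
-- entry), whereas the odd neighbour on the 12-cycle of each chain endpoint is matched
-- along the cycle and so occupies one of the two ends. Hence no chain is entered,
-- every box is matched internally, and H_i behaves like its 12-cycle with the chord
-- c0 c6 and the two outer edges at u_i, v_i. That graph is matched either through
-- both outer edges and the chord (M ∈ S_i) or by the even or odd cycle edges
-- (M ∉ S_i). Along the outer cycle the copies using their outer edges alternate, so
-- either H_1, H_3 or H_2, H_4 use them, and the two other copies choose a parity
-- each: 2 · 2 · 2 perfect matchings, four on each side.

module Submission where

open import Defs
open import Data.Bool using (Bool; true; false)
open import Data.Empty using (⊥; ⊥-elim)
open import Data.Fin using (Fin; toℕ; fromℕ<; #_; _≟_) renaming (zero to fz; suc to fs)
open import Data.Fin.Properties using (toℕ-fromℕ<; fromℕ<-toℕ; toℕ<n; toℕ-injective)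
open import Data.Fin.Subset using (_∈_)
open import Data.List using (List; []; _∷_; _++_; map; concatMap; upTo; applyUpTo; allFin; length; lookup; tabulate; cartesianProduct)
open import Data.List.Properties using (length-map; length-upTo)
import Data.List.Membership.Propositional as List
open import Data.List.Membership.Propositional.Properties
  using (∈-lookup; ∈-++⁺ˡ; ∈-++⁺ʳ; ∈-concatMap⁺; ∈-map⁺; ∈-map⁻; ∈-upTo⁺; ∈-allFin; ∈-cartesianProduct⁺)
open import Data.List.Relation.Unary.All using (All; []; _∷_)
import Data.List.Relation.Unary.All as All
import Data.List.Relation.Unary.All.Properties as All
open import Data.List.Relation.Unary.AllPairs using ([]; _∷_)
open import Data.List.Relation.Unary.Any using (here; there)
import Data.List.Relation.Unary.Any as Any
import Data.List.Relation.Unary.Any.Properties as Any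
open import Data.List.Relation.Unary.Unique.Propositional using (Unique)
import Data.List.Relation.Unary.Unique.Propositional.Properties as Unique
open import Data.Maybe using (just; nothing)
import Data.Maybe.Properties as Maybe
open import Data.Nat using (ℕ; zero; suc; _+_; _*_; _∸_; _≤_; _<_; z≤n; s≤s; _<?_; ⌊_/2⌋)
open import Data.Nat.Properties hiding (_≟_)
open import Data.Product using (_×_; _,_; ∃-syntax; proj₁; proj₂; Σ)
import Data.Product.Properties as Product
open import Data.Sum using (_⊎_; inj₁; inj₂; [_,_]′)
import Data.Sum.Properties as Sum
import Data.Vec as Vec
import Data.Vec.Properties as Vec
open import Function.Bundles using (mk⇔)
open import Relation.Binary.Definitions using (DecidableEquality)
open import Relation.Binary.PropositionalEquality
open import Relation.Nullary using (¬_; Dec; yes; no; does; _×-dec_)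
open import Relation.Nullary.Decidable using (map′; dec-true; dec-false)

pattern c0 = fz
pattern c1 = fs c0
pattern c2 = fs c1
pattern c3 = fs c2
pattern c4 = fs c3
pattern c5 = fs c4
pattern c6 = fs c5
pattern c7 = fs c6
pattern c8 = fs c7
pattern c9 = fs c8
pattern c10 = fs c9
pattern c11 = fs c10

offset : ∀ {n} → ℕ → (Fin n → ℕ) → Fin n → ℕ
offset o len fz = o
offset o len (fs m) = offset (o + len fz) (λ m → len (fs m)) m

offset-constant : ∀ {n} o b (m : Fin n) → offset o (λ _ → b) m ≡ toℕ m * b + o
offset-constant o b fz = refl
offset-constant o b (fs m) = trans (offset-constant (o + b) b m)
  (trans (cong (toℕ m * b +_) (+-comm o b))
    (trans (sym (+-assoc (toℕ m * b) b o)) (cong (_+ o) (+-comm (toℕ m * b) b))))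

infixr 5 _∷_

data Enumerates {A : Set} (f : A → ℕ) : ℕ → List A → Set where
  [] : ∀ {o} → Enumerates f o []
  _∷_ : ∀ {o x xs} → f x ≡ o → Enumerates f (suc o) xs → Enumerates f o (x ∷ xs)

module _ {A : Set} {f : A → ℕ} where

  enumerates-++ : ∀ {o o' xs ys} → Enumerates f o xs → Enumerates f o' ys →
                  o' ≡ o + length xs → Enumerates f o (xs ++ ys)
  enumerates-++ {o} [] ys eq = subst (λ z → Enumerates f z _) (trans eq (+-identityʳ o)) ys
  enumerates-++ {o} (_∷_ {xs = xs} p ps) ys eq = p ∷ enumerates-++ ps ys (trans eq (+-suc o (length xs)))

  enumerates-lookup : ∀ {o xs} → Enumerates f o xs → ∀ e → f (lookup xs e) ≡ toℕ e + o
  enumerates-lookup (p ∷ ps) fz = p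
  enumerates-lookup {o} (p ∷ ps) (fs e) = trans (enumerates-lookup ps e) (+-suc (toℕ e) o)

  enumerates-lookup-injective : ∀ {xs} → Enumerates f 0 xs → ∀ e e' → lookup xs e ≡ lookup xs e' → e ≡ e'
  enumerates-lookup-injective ps e e' eq = toℕ-injective (+-cancelʳ-≡ 0 (toℕ e) (toℕ e')
    (trans (sym (enumerates-lookup ps e)) (trans (cong f eq) (enumerates-lookup ps e'))))

  enumerates-applyUpTo : ∀ (g : ℕ → A) (h : ℕ → ℕ) n o →
    (∀ j → j < n → f (g (h j)) ≡ j + o) → Enumerates f o (map g (applyUpTo h n))
  enumerates-applyUpTo g h zero o hyp = []
  enumerates-applyUpTo g h (suc n) o hyp = hyp 0 (s≤s z≤n) ∷
    enumerates-applyUpTo g (λ j → h (suc j)) n (suc o) (λ j j<n → trans (hyp (suc j) (s≤s j<n)) (sym (+-suc j o)))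

  enumerates-concatMap : ∀ {B : Set} n (φ : Fin n → B) (t : B → List A) o →
    (∀ m → Enumerates f (offset o (λ m → length (t (φ m))) m) (t (φ m))) →
    Enumerates f o (concatMap t (tabulate φ))
  enumerates-concatMap zero φ t o ps = []
  enumerates-concatMap (suc n) φ t o ps =
    enumerates-++ (ps fz) (enumerates-concatMap n (λ m → φ (fs m)) t _ (λ m → ps (fs m))) refl

all-concatMap-allFin : ∀ {A : Set} {P : A → Set} {n} (f : Fin n → List A) → (∀ i → All P (f i)) →
  All P (concatMap f (allFin n))
all-concatMap-allFin {n = n} f ps = All.concat⁺ {xss = map f (allFin n)} (All.map⁺ {f = f} (All.tabulate⁺ {f = λ i → i} ps))

∈-concatMap-allFin⁺ : ∀ {A : Set} {n} (f : Fin n → List A) i {x} → x List.∈ f i → x List.∈ concatMap f (allFin n)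
∈-concatMap-allFin⁺ f i x∈ = ∈-concatMap⁺ f (List.lose (∈-allFin i) x∈)

hasExactly-image : ∀ {A B : Set} {P : B → Set} (f : A → B) {xs : List A} →
  (∀ {x y} → f x ≡ f y → x ≡ y) → Unique xs →
  (∀ {b} → P b → ∃[ x ] (x List.∈ xs × b ≡ f x)) → (∀ {x} → x List.∈ xs → P (f x)) →
  HasExactly P (length xs)
hasExactly-image {P = P} f {xs} f-injective unique complete sound =
  map f xs , length-map f xs , Unique.map⁺ f-injective unique , λ b → mk⇔ (to b) (from b)
  where
  to : ∀ b → P b → b List.∈ map f xs
  to b Pb = let (x , x∈ , b≡) = complete Pb in subst (List._∈ map f xs) (sym b≡) (∈-map⁺ f x∈)
  from : ∀ b → b List.∈ map f xs → P b
  from b b∈ = let (x , x∈ , b≡) = ∈-map⁻ f b∈ in subst P (sym b≡) (sound x∈)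

resolve₁ : ∀ {A B : Set} → A ⊎ B → ¬ B → A
resolve₁ (inj₁ a) _ = a
resolve₁ (inj₂ b) ¬b = ⊥-elim (¬b b)

resolve₂ : ∀ {A B : Set} → A ⊎ B → ¬ A → B
resolve₂ (inj₁ a) ¬a = ⊥-elim (¬a a)
resolve₂ (inj₂ b) _ = b

⌊2*n/2⌋≡n : ∀ n → ⌊ 2 * n /2⌋ ≡ n
⌊2*n/2⌋≡n zero = refl
⌊2*n/2⌋≡n (suc n) = trans (cong ⌊_/2⌋ (*-suc 2 n)) (cong suc (⌊2*n/2⌋≡n n))

⌊1+2*n/2⌋≡n : ∀ n → ⌊ suc (2 * n) /2⌋ ≡ n
⌊1+2*n/2⌋≡n zero = refl
⌊1+2*n/2⌋≡n (suc n) = trans (cong (λ m → ⌊ suc m /2⌋) (*-suc 2 n)) (cong suc (⌊1+2*n/2⌋≡n n))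

even-or-odd : ∀ n → n ≡ 2 * ⌊ n /2⌋ ⊎ n ≡ suc (2 * ⌊ n /2⌋)
even-or-odd zero = inj₁ refl
even-or-odd (suc zero) = inj₂ refl
even-or-odd (suc (suc n)) with even-or-odd n
... | inj₁ eq = inj₁ (trans (cong (λ m → suc (suc m)) eq) (sym (*-suc 2 ⌊ n /2⌋)))
... | inj₂ eq = inj₂ (trans (cong (λ m → suc (suc m)) eq) (cong suc (sym (*-suc 2 ⌊ n /2⌋))))

2*⌊n/2⌋≤n : ∀ n → 2 * ⌊ n /2⌋ ≤ n
2*⌊n/2⌋≤n n with even-or-odd n
... | inj₁ eq = ≤-reflexive (sym eq)
... | inj₂ eq = subst (2 * ⌊ n /2⌋ ≤_) (sym eq) (n≤1+n _)

module Counterexample (k' : ℕ) where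

  k : ℕ
  k = suc k'

  L : ℕ
  L = 2 * k ∸ 2

  L≡ : L ≡ 2 * k'
  L≡ = cong (_∸ 2) (*-suc 2 k')

  pathLength≡ : 2 * k ∸ 1 ≡ suc L
  pathLength≡ = trans (cong (_∸ 1) (*-suc 2 k')) (cong suc (sym L≡))

  chainV : Fin 4 → Fin 4 → ℕ → V k
  chainV = pathV k

  chainV-internal : ∀ {i r j} (p : j < L) → chainV i r (suc j) ≡ pathInt i r (fromℕ< p)
  chainV-internal {j = j} p with j <? L
  ... | yes _ = refl
  ... | no ¬p = ⊥-elim (¬p p)

  chainV-end : ∀ {i r j} → ¬ j < L → chainV i r (suc j) ≡ cyc i (chainEnd r)
  chainV-end {j = j} ¬p with j <? L
  ... | yes p = ⊥-elim (¬p p)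
  ... | no _ = refl

  chainV-last : ∀ {i r} → chainV i r (suc L) ≡ cyc i (chainEnd r)
  chainV-last = chainV-end (<-irrefl refl)

  chainV≡pathInt : ∀ {i r J i' r' x} → chainV i r J ≡ pathInt i' r' x → i ≡ i' × r ≡ r' × J ≡ suc (toℕ x)
  chainV≡pathInt {J = zero} ()
  chainV≡pathInt {J = suc j} eq with j <? L
  chainV≡pathInt {J = suc j} refl | yes p = refl , refl , cong suc (sym (toℕ-fromℕ< p))
  chainV≡pathInt {J = suc j} () | no _

  chainV≡pathInt-toℕ : ∀ {i r} (j : Fin L) → chainV i r (suc (toℕ j)) ≡ pathInt i r j
  chainV≡pathInt-toℕ j = trans (chainV-internal (toℕ<n j)) (cong (pathInt _ _) (fromℕ<-toℕ j (toℕ<n j)))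

  chainV≡cyc : ∀ {i r J i' a} → chainV i r J ≡ cyc i' a →
    i ≡ i' × ((J ≡ 0 × a ≡ chainStart r) ⊎ (suc L ≤ J × a ≡ chainEnd r))
  chainV≡cyc {J = zero} refl = refl , inj₁ (refl , refl)
  chainV≡cyc {J = suc j} eq with j <? L
  chainV≡cyc {J = suc j} () | yes _
  chainV≡cyc {J = suc j} refl | no ¬p = refl , inj₂ (s≤s (≮⇒≥ ¬p) , refl)

  chainV≢top : ∀ {i r J t} → ¬ chainV i r J ≡ top t
  chainV≢top {J = zero} ()
  chainV≢top {J = suc j} eq with j <? L
  chainV≢top {J = suc j} () | yes _
  chainV≢top {J = suc j} () | no _

  chainV≢boxA : ∀ {i r J i' r' m} → ¬ chainV i r J ≡ boxA i' r' m
  chainV≢boxA {J = zero} ()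
  chainV≢boxA {J = suc j} eq with j <? L
  chainV≢boxA {J = suc j} () | yes _
  chainV≢boxA {J = suc j} () | no _

  chainV≢boxB : ∀ {i r J i' r' m} → ¬ chainV i r J ≡ boxB i' r' m
  chainV≢boxB {J = zero} ()
  chainV≢boxB {J = suc j} eq with j <? L
  chainV≢boxB {J = suc j} () | yes _
  chainV≢boxB {J = suc j} () | no _

  chainStart≢chainEnd : ∀ r → ¬ chainStart r ≡ chainEnd r
  chainStart≢chainEnd fz ()
  chainStart≢chainEnd (fs fz) ()
  chainStart≢chainEnd (fs (fs fz)) ()
  chainStart≢chainEnd (fs (fs (fs fz))) ()

  chainV≡start : ∀ {i r J} → chainV i r J ≡ chainV i r 0 → J ≡ 0
  chainV≡start {i} {r} {J} eq with chainV≡cyc {i} {r} {J} eq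
  ... | _ , inj₁ (J≡0 , _) = J≡0
  ... | _ , inj₂ (_ , start≡end) = ⊥-elim (chainStart≢chainEnd r start≡end)

  chainV≡end : ∀ {i r J} → chainV i r J ≡ chainV i r (suc L) → suc L ≤ J
  chainV≡end {i} {r} {J} eq with chainV≡cyc {i} {r} {J} (trans eq chainV-last)
  ... | _ , inj₁ (_ , end≡start) = ⊥-elim (chainStart≢chainEnd r (sym end≡start))
  ... | _ , inj₂ (le , _) = le

  1+2n<L : ∀ {n} → suc n < k → suc (2 * n) < L
  1+2n<L {n} lt = subst (suc (2 * n) <_) (sym L≡) (subst (_≤ 2 * k') (*-suc 2 n) (*-monoʳ-≤ 2 (≤-pred lt)))

  2n<L : ∀ {n} → suc n < k → 2 * n < L
  2n<L lt = <-trans (n<1+n _) (1+2n<L lt)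

  2m≤L : ∀ (m : Fin k) → 2 * toℕ m ≤ L
  2m≤L m = subst (2 * toℕ m ≤_) (sym L≡) (*-monoʳ-≤ 2 (≤-pred (toℕ<n m)))

  tu vt : Fin 4 → Edge k
  tu i = edge nothing (top i) (uV i)
  vt i = edge nothing (vV i) (top (nextTop i))

  cycE : Fin 4 → Fin 12 → Fin 12 → Edge k
  cycE i a b = edge (just i) (cyc i a) (cyc i b)

  pathE : Fin 4 → Fin 4 → ℕ → Edge k
  pathE i r J = edge (just i) (chainV i r J) (chainV i r (suc J))

  boxEntry boxMid boxExit : Fin 4 → Fin 4 → Fin k → Edge k
  boxEntry i r m = edge (just i) (chainV i r (2 * toℕ m)) (boxA i r m)
  boxMid i r m = edge (just i) (boxA i r m) (boxB i r m)
  boxExit i r m = edge (just i) (boxB i r m) (chainV i r (suc (2 * toℕ m)))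

  box : Fin 4 → Fin 4 → Fin k → List (Edge k)
  box i r m = boxEntry i r m ∷ boxMid i r m ∷ boxExit i r m ∷ []

  offH : Fin 4 → ℕ
  offH = offset 8 (λ i → length (HEdges k i))

  offC : Fin 4 → Fin 4 → ℕ
  offC i = offset (13 + offH i) (λ r → length (chainEdges k i r))

  offB : Fin 4 → Fin 4 → ℕ
  offB i r = suc L + offC i r

  -- The last four entries are the first path edges of the chains: for k = 1
  -- such an edge joins two cycle vertices.
  cycPos : Fin 4 → ℕ → ℕ → ℕ
  cycPos i 0 1 = 0 + offH i
  cycPos i 1 2 = 1 + offH i
  cycPos i 2 3 = 2 + offH i
  cycPos i 3 4 = 3 + offH i
  cycPos i 4 5 = 4 + offH i
  cycPos i 5 6 = 5 + offH i
  cycPos i 6 7 = 6 + offH i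
  cycPos i 7 8 = 7 + offH i
  cycPos i 8 9 = 8 + offH i
  cycPos i 9 10 = 9 + offH i
  cycPos i 10 11 = 10 + offH i
  cycPos i 11 0 = 11 + offH i
  cycPos i 0 6 = 12 + offH i
  cycPos i 2 0 = offC i (# 0)
  cycPos i 0 10 = offC i (# 1)
  cycPos i 4 6 = offC i (# 2)
  cycPos i 6 8 = offC i (# 3)
  cycPos i _ _ = 0

  posH : V k → V k → ℕ
  posH (cyc i a) (cyc _ b) = cycPos i (toℕ a) (toℕ b)
  posH (cyc _ _) (pathInt i r _) = offC i r
  posH (cyc _ _) (boxA i r m) = toℕ m * 3 + offB i r
  posH (pathInt _ _ _) (boxA i r m) = toℕ m * 3 + offB i r
  posH (pathInt i r j) _ = suc (toℕ j) + offC i r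
  posH (boxA i r m) _ = suc (toℕ m * 3) + offB i r
  posH (boxB i r m) _ = suc (suc (toℕ m * 3)) + offB i r
  posH _ _ = 0

  -- The index of an edge in edges k (see edges-enumerated); 0 on non-edges.
  pos : Edge k → ℕ
  pos (edge nothing (top i) _) = 2 * toℕ i
  pos (edge nothing (cyc i _) _) = suc (2 * toℕ i)
  pos (edge nothing _ _) = 0
  pos (edge (just _) x y) = posH x y

  pos-firstPathE : ∀ i r → cycPos i (toℕ (chainStart r)) (toℕ (chainEnd r)) ≡ offC i r
  pos-firstPathE i fz = refl
  pos-firstPathE i (fs fz) = refl
  pos-firstPathE i (fs (fs fz)) = refl
  pos-firstPathE i (fs (fs (fs fz))) = refl

  posH-pathInt : ∀ {i r x y} → (∀ {i' r' m} → ¬ y ≡ boxA i' r' m) → posH (pathInt i r x) y ≡ suc (toℕ x) + offC i r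
  posH-pathInt {y = top _} _ = refl
  posH-pathInt {y = cyc _ _} _ = refl
  posH-pathInt {y = pathInt _ _ _} _ = refl
  posH-pathInt {y = boxA _ _ _} y≢boxA = ⊥-elim (y≢boxA refl)
  posH-pathInt {y = boxB _ _ _} _ = refl

  pos-pathE : ∀ i r j → j < 2 * k ∸ 1 → pos (pathE i r j) ≡ j + offC i r
  pos-pathE i r zero _ = first (0 <? L)
    where
    first : Dec (0 < L) → pos (pathE i r 0) ≡ offC i r
    first (yes p) = cong (posH (cyc i (chainStart r))) (chainV-internal p)
    first (no ¬p) = trans (cong (posH (cyc i (chainStart r))) (chainV-end ¬p)) (pos-firstPathE i r)
  pos-pathE i r (suc j) lt =
    trans (cong (λ x → posH x (chainV i r (suc (suc j)))) (chainV-internal p))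
      (trans (posH-pathInt {y = chainV i r (suc (suc j))} chainV≢boxA) (cong (λ z → suc z + offC i r) (toℕ-fromℕ< p)))
    where
    p : j < L
    p = ≤-pred (subst (suc (suc j) ≤_) pathLength≡ lt)

  posH-boxA : ∀ {i r J i' r' m} → posH (chainV i r J) (boxA i' r' m) ≡ toℕ m * 3 + offB i' r'
  posH-boxA {J = zero} = refl
  posH-boxA {J = suc j} with j <? L
  ... | yes _ = refl
  ... | no _ = refl

  chainEdges-enumerated : ∀ i r → Enumerates pos (offC i r) (chainEdges k i r)
  chainEdges-enumerated i r = enumerates-++
    (enumerates-applyUpTo (pathE i r) (λ j → j) (2 * k ∸ 1) (offC i r) (λ j lt → pos-pathE i r j lt))
    (enumerates-concatMap k (λ m → m) (box i r) (offB i r)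
      (λ m → subst (λ o → Enumerates pos o (box i r m))
                   (sym (offset-constant (offB i r) 3 m)) (posH-boxA {i} {r} {2 * toℕ m} ∷ refl ∷ refl ∷ [])))
    (trans (+-comm (suc L) (offC i r))
      (cong (offC i r +_) (sym (trans (length-map (pathE i r) (upTo (2 * k ∸ 1)))
                                      (trans (length-upTo (2 * k ∸ 1)) pathLength≡)))))

  HEdges-enumerated : ∀ i → Enumerates pos (offH i) (HEdges k i)
  HEdges-enumerated i = enumerates-++
    (refl ∷ refl ∷ refl ∷ refl ∷ refl ∷ refl ∷ refl ∷ refl ∷ refl ∷ refl ∷ refl ∷ refl ∷ refl ∷ [])
    (enumerates-concatMap 4 (λ r → r) (chainEdges k i) (13 + offH i) (chainEdges-enumerated i))
    (+-comm 13 (offH i))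

  edges-enumerated : Enumerates pos 0 (edges k)
  edges-enumerated = enumerates-++ (refl ∷ refl ∷ refl ∷ refl ∷ refl ∷ refl ∷ refl ∷ refl ∷ [])
    (enumerates-concatMap 4 (λ i → i) (HEdges k) 8 HEdges-enumerated) refl

  edgeAt-injective : ∀ e e' → edgeAt k e ≡ edgeAt k e' → e ≡ e'
  edgeAt-injective = enumerates-lookup-injective edges-enumerated

  data CycleEdge : Fin 12 → Fin 12 → Set where
    e0-1 : CycleEdge c0 c1
    e1-2 : CycleEdge c1 c2
    e2-3 : CycleEdge c2 c3
    e3-4 : CycleEdge c3 c4
    e4-5 : CycleEdge c4 c5
    e5-6 : CycleEdge c5 c6
    e6-7 : CycleEdge c6 c7
    e7-8 : CycleEdge c7 c8
    e8-9 : CycleEdge c8 c9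
    e9-10 : CycleEdge c9 c10
    e10-11 : CycleEdge c10 c11
    e11-0 : CycleEdge c11 c0
    e0-6 : CycleEdge c0 c6

  data ChainEdge (i r : Fin 4) : Edge k → Set where
    path : ∀ J → J < suc L → ChainEdge i r (pathE i r J)
    entry : ∀ m → ChainEdge i r (boxEntry i r m)
    mid : ∀ m → ChainEdge i r (boxMid i r m)
    exit : ∀ m → ChainEdge i r (boxExit i r m)

  data IsEdge : Edge k → Set where
    outer-tu : ∀ i → IsEdge (tu i)
    outer-vt : ∀ i → IsEdge (vt i)
    cycle : ∀ i {a b} → CycleEdge a b → IsEdge (cycE i a b)
    chain : ∀ i r {ed} → ChainEdge i r ed → IsEdge ed

  chainEdge≢cycleEdge : ∀ {i r ed i' a b} → ChainEdge i r ed → ed ≡ cycE i' a b → ¬ CycleEdge a b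
  chainEdge≢cycleEdge {i} {r} (path J lt) eq = ends (chainV≡cyc {i} {r} {J} (cong end₁ eq)) (chainV≡cyc {i} {r} {suc J} (cong end₂ eq))
    where
    not-cycleEdge : ∀ r → ¬ CycleEdge (chainStart r) (chainEnd r)
    not-cycleEdge fz ()
    not-cycleEdge (fs fz) ()
    not-cycleEdge (fs (fs fz)) ()
    not-cycleEdge (fs (fs (fs fz))) ()
    ends : ∀ {i' a b} → i ≡ i' × ((J ≡ 0 × a ≡ chainStart r) ⊎ (suc L ≤ J × a ≡ chainEnd r)) →
      i ≡ i' × ((suc J ≡ 0 × b ≡ chainStart r) ⊎ (suc L ≤ suc J × b ≡ chainEnd r)) → ¬ CycleEdge a b
    ends (_ , inj₁ (_ , refl)) (_ , inj₂ (_ , refl)) = not-cycleEdge r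
    ends (_ , inj₂ (le , _)) _ _ = <-irrefl refl (≤-trans lt le)
  chainEdge≢cycleEdge (entry m) eq with () ← cong end₂ eq
  chainEdge≢cycleEdge (mid m) eq with () ← cong end₁ eq
  chainEdge≢cycleEdge (exit m) eq with () ← cong end₁ eq

  edges-isEdge : All IsEdge (edges k)
  edges-isEdge = All.++⁺ {xs = outerEdges k}
    (all-concatMap-allFin (λ i → tu i ∷ vt i ∷ []) (λ i → outer-tu i ∷ outer-vt i ∷ []))
    (all-concatMap-allFin (HEdges k) λ i → All.++⁺ {xs = cycleEdges k i}
      (cycle i e0-1 ∷ cycle i e1-2 ∷ cycle i e2-3 ∷ cycle i e3-4 ∷ cycle i e4-5 ∷ cycle i e5-6 ∷ cycle i e6-7 ∷
       cycle i e7-8 ∷ cycle i e8-9 ∷ cycle i e9-10 ∷ cycle i e10-11 ∷ cycle i e11-0 ∷ cycle i e0-6 ∷ [])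
      (all-concatMap-allFin (chainEdges k i) λ r → All.++⁺
        (All.map⁺ (All.applyUpTo⁺₁ (λ j → j) (2 * k ∸ 1) (λ {j} lt → chain i r (path j (subst (j <_) pathLength≡ lt)))))
        (all-concatMap-allFin (box i r) (λ m → chain i r (entry m) ∷ chain i r (mid m) ∷ chain i r (exit m) ∷ []))))

  edgeAt-isEdge : ∀ e → IsEdge (edgeAt k e)
  edgeAt-isEdge e = All.lookup edges-isEdge (∈-lookup e)

  cycleEdge-∈ : ∀ i {a b} → CycleEdge a b → cycE i a b List.∈ cycleEdges k i
  cycleEdge-∈ i e0-1 = here refl
  cycleEdge-∈ i e1-2 = there (here refl)
  cycleEdge-∈ i e2-3 = there (there (here refl))
  cycleEdge-∈ i e3-4 = there (there (there (here refl)))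
  cycleEdge-∈ i e4-5 = there (there (there (there (here refl))))
  cycleEdge-∈ i e5-6 = there (there (there (there (there (here refl)))))
  cycleEdge-∈ i e6-7 = there (there (there (there (there (there (here refl))))))
  cycleEdge-∈ i e7-8 = there (there (there (there (there (there (there (here refl)))))))
  cycleEdge-∈ i e8-9 = there (there (there (there (there (there (there (there (here refl))))))))
  cycleEdge-∈ i e9-10 = there (there (there (there (there (there (there (there (there (here refl)))))))))
  cycleEdge-∈ i e10-11 = there (there (there (there (there (there (there (there (there (there (here refl))))))))))
  cycleEdge-∈ i e11-0 = there (there (there (there (there (there (there (there (there (there (there (here refl)))))))))))
  cycleEdge-∈ i e0-6 = there (there (there (there (there (there (there (there (there (there (there (there (here refl))))))))))))

  chainEdge-∈ : ∀ i r {ed} → ChainEdge i r ed → ed List.∈ chainEdges k i r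
  chainEdge-∈ i r (path J lt) = ∈-++⁺ˡ (∈-map⁺ (pathE i r) (∈-upTo⁺ (subst (J <_) (sym pathLength≡) lt)))
  chainEdge-∈ i r (entry m) = ∈-++⁺ʳ _ (∈-concatMap-allFin⁺ (box i r) m (here refl))
  chainEdge-∈ i r (mid m) = ∈-++⁺ʳ _ (∈-concatMap-allFin⁺ (box i r) m (there (here refl)))
  chainEdge-∈ i r (exit m) = ∈-++⁺ʳ _ (∈-concatMap-allFin⁺ (box i r) m (there (there (here refl))))

  isEdge⇒∈ : ∀ {ed} → IsEdge ed → ed List.∈ edges k
  isEdge⇒∈ (outer-tu i) = ∈-++⁺ˡ (∈-concatMap-allFin⁺ (λ i → tu i ∷ vt i ∷ []) i (here refl))
  isEdge⇒∈ (outer-vt i) = ∈-++⁺ˡ (∈-concatMap-allFin⁺ (λ i → tu i ∷ vt i ∷ []) i (there (here refl)))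
  isEdge⇒∈ (cycle i e) = ∈-++⁺ʳ (outerEdges k) (∈-concatMap-allFin⁺ (HEdges k) i (∈-++⁺ˡ (cycleEdge-∈ i e)))
  isEdge⇒∈ (chain i r c) = ∈-++⁺ʳ (outerEdges k) (∈-concatMap-allFin⁺ (HEdges k) i
    (∈-++⁺ʳ (cycleEdges k i) (∈-concatMap-allFin⁺ (chainEdges k i) r (chainEdge-∈ i r c))))

  previous : Fin 4 → Fin 4
  previous fz = # 3
  previous (fs fz) = # 0
  previous (fs (fs fz)) = # 1
  previous (fs (fs (fs fz))) = # 2

  incident-top : ∀ {t ed} → IsEdge ed → Incident (top t) ed → ed ≡ tu t ⊎ ed ≡ vt (previous t)
  incident-top (outer-tu i) (inj₁ refl) = inj₁ refl
  incident-top (outer-tu i) (inj₂ ())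
  incident-top (outer-vt i) (inj₁ ())
  incident-top (outer-vt fz) (inj₂ refl) = inj₂ refl
  incident-top (outer-vt (fs fz)) (inj₂ refl) = inj₂ refl
  incident-top (outer-vt (fs (fs fz))) (inj₂ refl) = inj₂ refl
  incident-top (outer-vt (fs (fs (fs fz)))) (inj₂ refl) = inj₂ refl
  incident-top (cycle i _) (inj₁ ())
  incident-top (cycle i _) (inj₂ ())
  incident-top (chain i r (path J _)) (inj₁ eq) = ⊥-elim (chainV≢top {i} {r} {J} eq)
  incident-top (chain i r (path J _)) (inj₂ eq) = ⊥-elim (chainV≢top {i} {r} {suc J} eq)
  incident-top (chain i r (entry m)) (inj₁ eq) = ⊥-elim (chainV≢top {i} {r} {2 * toℕ m} eq)
  incident-top (chain i r (entry m)) (inj₂ ())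
  incident-top (chain i r (mid m)) (inj₁ ())
  incident-top (chain i r (mid m)) (inj₂ ())
  incident-top (chain i r (exit m)) (inj₁ ())
  incident-top (chain i r (exit m)) (inj₂ eq) = ⊥-elim (chainV≢top {i} {r} {suc (2 * toℕ m)} eq)

  cycleStar : Fin 4 → ℕ → List (Edge k)
  cycleStar i 0 = cycE i c11 c0 ∷ cycE i c0 c1 ∷ cycE i c0 c6 ∷ []
  cycleStar i 1 = cycE i c0 c1 ∷ cycE i c1 c2 ∷ []
  cycleStar i 2 = cycE i c1 c2 ∷ cycE i c2 c3 ∷ []
  cycleStar i 3 = cycE i c2 c3 ∷ cycE i c3 c4 ∷ tu i ∷ []
  cycleStar i 4 = cycE i c3 c4 ∷ cycE i c4 c5 ∷ []
  cycleStar i 5 = cycE i c4 c5 ∷ cycE i c5 c6 ∷ []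
  cycleStar i 6 = cycE i c5 c6 ∷ cycE i c6 c7 ∷ cycE i c0 c6 ∷ []
  cycleStar i 7 = cycE i c6 c7 ∷ cycE i c7 c8 ∷ []
  cycleStar i 8 = cycE i c7 c8 ∷ cycE i c8 c9 ∷ []
  cycleStar i 9 = cycE i c8 c9 ∷ cycE i c9 c10 ∷ vt i ∷ []
  cycleStar i 10 = cycE i c9 c10 ∷ cycE i c10 c11 ∷ []
  cycleStar i 11 = cycE i c10 c11 ∷ cycE i c11 c0 ∷ []
  cycleStar i _ = []

  cycleEdge-star : ∀ i {a b} → CycleEdge a b →
    cycE i a b List.∈ cycleStar i (toℕ a) × cycE i a b List.∈ cycleStar i (toℕ b)
  cycleEdge-star i e0-1 = there (here refl) , here refl
  cycleEdge-star i e1-2 = there (here refl) , here refl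
  cycleEdge-star i e2-3 = there (here refl) , here refl
  cycleEdge-star i e3-4 = there (here refl) , here refl
  cycleEdge-star i e4-5 = there (here refl) , here refl
  cycleEdge-star i e5-6 = there (here refl) , here refl
  cycleEdge-star i e6-7 = there (here refl) , here refl
  cycleEdge-star i e7-8 = there (here refl) , here refl
  cycleEdge-star i e8-9 = there (here refl) , here refl
  cycleEdge-star i e9-10 = there (here refl) , here refl
  cycleEdge-star i e10-11 = there (here refl) , here refl
  cycleEdge-star i e11-0 = there (here refl) , here refl
  cycleEdge-star i e0-6 = there (there (here refl)) , there (there (here refl))

  ChainEndAt : Fin 4 → Fin 12 → Edge k → Set
  ChainEndAt i a ed = Σ (Fin 4) λ r → ChainEdge i r ed ×
    ((Incident (chainV i r 0) ed × a ≡ chainStart r) ⊎ (Incident (chainV i r (suc L)) ed × a ≡ chainEnd r))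

  incident-cyc : ∀ {i a ed} → IsEdge ed → Incident (cyc i a) ed → ed List.∈ cycleStar i (toℕ a) ⊎ ChainEndAt i a ed
  incident-cyc (outer-tu i) (inj₁ ())
  incident-cyc (outer-tu i) (inj₂ refl) = inj₁ (there (there (here refl)))
  incident-cyc (outer-vt i) (inj₁ refl) = inj₁ (there (there (here refl)))
  incident-cyc (outer-vt i) (inj₂ ())
  incident-cyc (cycle i e) (inj₁ refl) = inj₁ (proj₁ (cycleEdge-star i e))
  incident-cyc (cycle i e) (inj₂ refl) = inj₁ (proj₂ (cycleEdge-star i e))
  incident-cyc (chain i r (path J lt)) (inj₁ eq) with chainV≡cyc {J = J} eq
  ... | refl , inj₁ (refl , refl) = inj₂ (r , path 0 lt , inj₁ (inj₁ refl , refl))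
  ... | refl , inj₂ (le , _) = ⊥-elim (<-irrefl refl (≤-trans lt le))
  incident-cyc (chain i r (path J lt)) (inj₂ eq) with chainV≡cyc {J = suc J} eq
  ... | refl , inj₁ (() , _)
  ... | refl , inj₂ (le , refl) =
    inj₂ (r , path J lt , inj₂ (inj₂ (cong (λ z → chainV i r (suc z)) (≤-antisym (≤-pred lt) (≤-pred le))) , refl))
  incident-cyc (chain i r (entry m)) (inj₁ eq) with chainV≡cyc {J = 2 * toℕ m} eq
  ... | refl , inj₁ (J≡0 , refl) = inj₂ (r , entry m , inj₁ (inj₁ (cong (chainV i r) J≡0) , refl))
  ... | refl , inj₂ (le , _) = ⊥-elim (<-irrefl refl (≤-trans (s≤s (2m≤L m)) le))
  incident-cyc (chain i r (entry m)) (inj₂ ())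
  incident-cyc (chain i r (mid m)) (inj₁ ())
  incident-cyc (chain i r (mid m)) (inj₂ ())
  incident-cyc (chain i r (exit m)) (inj₁ ())
  incident-cyc (chain i r (exit m)) (inj₂ eq) with chainV≡cyc {J = suc (2 * toℕ m)} eq
  ... | refl , inj₁ (() , _)
  ... | refl , inj₂ (le , refl) =
    inj₂ (r , exit m , inj₂ (inj₂ (cong (chainV i r) (≤-antisym (s≤s (2m≤L m)) le)) , refl))

  incident-boxA : ∀ {i r m ed} → IsEdge ed → Incident (boxA i r m) ed → ed ≡ boxEntry i r m ⊎ ed ≡ boxMid i r m
  incident-boxA (outer-tu i) (inj₁ ())
  incident-boxA (outer-tu i) (inj₂ ())
  incident-boxA (outer-vt i) (inj₁ ())
  incident-boxA (outer-vt i) (inj₂ ())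
  incident-boxA (cycle i _) (inj₁ ())
  incident-boxA (cycle i _) (inj₂ ())
  incident-boxA (chain i r (path J _)) (inj₁ eq) = ⊥-elim (chainV≢boxA {i} {r} {J} eq)
  incident-boxA (chain i r (path J _)) (inj₂ eq) = ⊥-elim (chainV≢boxA {i} {r} {suc J} eq)
  incident-boxA (chain i r (entry m)) (inj₁ eq) = ⊥-elim (chainV≢boxA {i} {r} {2 * toℕ m} eq)
  incident-boxA (chain i r (entry m)) (inj₂ refl) = inj₁ refl
  incident-boxA (chain i r (mid m)) (inj₁ refl) = inj₂ refl
  incident-boxA (chain i r (mid m)) (inj₂ ())
  incident-boxA (chain i r (exit m)) (inj₁ ())
  incident-boxA (chain i r (exit m)) (inj₂ eq) = ⊥-elim (chainV≢boxA {i} {r} {suc (2 * toℕ m)} eq)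

  incident-boxB : ∀ {i r m ed} → IsEdge ed → Incident (boxB i r m) ed → ed ≡ boxMid i r m ⊎ ed ≡ boxExit i r m
  incident-boxB (outer-tu i) (inj₁ ())
  incident-boxB (outer-tu i) (inj₂ ())
  incident-boxB (outer-vt i) (inj₁ ())
  incident-boxB (outer-vt i) (inj₂ ())
  incident-boxB (cycle i _) (inj₁ ())
  incident-boxB (cycle i _) (inj₂ ())
  incident-boxB (chain i r (path J _)) (inj₁ eq) = ⊥-elim (chainV≢boxB {i} {r} {J} eq)
  incident-boxB (chain i r (path J _)) (inj₂ eq) = ⊥-elim (chainV≢boxB {i} {r} {suc J} eq)
  incident-boxB (chain i r (entry m)) (inj₁ eq) = ⊥-elim (chainV≢boxB {i} {r} {2 * toℕ m} eq)
  incident-boxB (chain i r (entry m)) (inj₂ ())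
  incident-boxB (chain i r (mid m)) (inj₁ ())
  incident-boxB (chain i r (mid m)) (inj₂ refl) = inj₁ refl
  incident-boxB (chain i r (exit m)) (inj₁ refl) = inj₂ refl
  incident-boxB (chain i r (exit m)) (inj₂ eq) = ⊥-elim (chainV≢boxB {i} {r} {suc (2 * toℕ m)} eq)

  PathStar : Fin 4 → Fin 4 → ℕ → Edge k → Set
  PathStar i r j ed = ed ≡ pathE i r j ⊎ ed ≡ pathE i r (suc j) ⊎
    (Σ (Fin k) λ m → 2 * toℕ m ≡ suc j × ed ≡ boxEntry i r m) ⊎
    (Σ (Fin k) λ m → 2 * toℕ m ≡ j × ed ≡ boxExit i r m)

  incident-pathInt : ∀ {i r j ed} (x : Fin L) → toℕ x ≡ j → IsEdge ed → Incident (pathInt i r x) ed → PathStar i r j ed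
  incident-pathInt x tx (outer-tu i) (inj₁ ())
  incident-pathInt x tx (outer-tu i) (inj₂ ())
  incident-pathInt x tx (outer-vt i) (inj₁ ())
  incident-pathInt x tx (outer-vt i) (inj₂ ())
  incident-pathInt x tx (cycle i _) (inj₁ ())
  incident-pathInt x tx (cycle i _) (inj₂ ())
  incident-pathInt x tx (chain i r (path J _)) (inj₁ eq) with chainV≡pathInt {J = J} eq
  ... | refl , refl , e = inj₂ (inj₁ (cong (pathE i r) (trans e (cong suc tx))))
  incident-pathInt x tx (chain i r (path J _)) (inj₂ eq) with chainV≡pathInt {J = suc J} eq
  ... | refl , refl , e = inj₁ (cong (pathE i r) (trans (suc-injective e) tx))
  incident-pathInt x tx (chain i r (entry m)) (inj₁ eq) with chainV≡pathInt {J = 2 * toℕ m} eq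
  ... | refl , refl , e = inj₂ (inj₂ (inj₁ (m , trans e (cong suc tx) , refl)))
  incident-pathInt x tx (chain i r (entry m)) (inj₂ ())
  incident-pathInt x tx (chain i r (mid m)) (inj₁ ())
  incident-pathInt x tx (chain i r (mid m)) (inj₂ ())
  incident-pathInt x tx (chain i r (exit m)) (inj₁ ())
  incident-pathInt x tx (chain i r (exit m)) (inj₂ eq) with chainV≡pathInt {J = suc (2 * toℕ m)} eq
  ... | refl , refl , e = inj₂ (inj₂ (inj₂ (m , trans (suc-injective e) tx , refl)))

  incident-chainV : ∀ {i r j ed} (p : j < L) → IsEdge ed → Incident (chainV i r (suc j)) ed → PathStar i r j ed
  incident-chainV {i} {r} {ed = ed} p isE inc =
    incident-pathInt (fromℕ< p) (toℕ-fromℕ< p) isE (subst (λ x → Incident x ed) (chainV-internal p) inc)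

  -- Perfect matchings as mate functions

  VCode : Set
  VCode = Fin 4 ⊎ (Fin 4 × Fin 12) ⊎ (Fin 4 × Fin 4 × Fin L) ⊎ (Fin 4 × Fin 4 × Fin k) ⊎ (Fin 4 × Fin 4 × Fin k)

  encode : V k → VCode
  encode (top t) = inj₁ t
  encode (cyc i a) = inj₂ (inj₁ (i , a))
  encode (pathInt i r j) = inj₂ (inj₂ (inj₁ (i , r , j)))
  encode (boxA i r m) = inj₂ (inj₂ (inj₂ (inj₁ (i , r , m))))
  encode (boxB i r m) = inj₂ (inj₂ (inj₂ (inj₂ (i , r , m))))

  decode : VCode → V k
  decode (inj₁ t) = top t
  decode (inj₂ (inj₁ (i , a))) = cyc i a
  decode (inj₂ (inj₂ (inj₁ (i , r , j)))) = pathInt i r j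
  decode (inj₂ (inj₂ (inj₂ (inj₁ (i , r , m))))) = boxA i r m
  decode (inj₂ (inj₂ (inj₂ (inj₂ (i , r , m))))) = boxB i r m

  decode-encode : ∀ x → decode (encode x) ≡ x
  decode-encode (top _) = refl
  decode-encode (cyc _ _) = refl
  decode-encode (pathInt _ _ _) = refl
  decode-encode (boxA _ _ _) = refl
  decode-encode (boxB _ _ _) = refl

  _≟V_ : DecidableEquality (V k)
  x ≟V y = map′ (λ eq → trans (sym (decode-encode x)) (trans (cong decode eq) (decode-encode y))) (cong encode)
    (Sum.≡-dec _≟_ (Sum.≡-dec (Product.≡-dec _≟_ _≟_)
      (Sum.≡-dec triple (Sum.≡-dec triple triple))) (encode x) (encode y))
    where
    triple : ∀ {n} → DecidableEquality (Fin 4 × Fin 4 × Fin n)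
    triple = Product.≡-dec _≟_ (Product.≡-dec _≟_ _≟_)

  _≟E_ : DecidableEquality (Edge k)
  edge o a b ≟E edge o' a' b' = map′ (λ { (refl , refl , refl) → refl }) (λ { refl → refl , refl , refl })
    (Maybe.≡-dec _≟_ o o' ×-dec a ≟V a' ×-dec b ≟V b')

  infix 4 _∈ₑ_
  _∈ₑ_ : Edge k → EdgeSet k → Set
  ed ∈ₑ M = ∃[ e ] (e ∈ M × edgeAt k e ≡ ed)

  isEdge⇒position : ∀ {ed} → IsEdge ed → ∃[ e ] (edgeAt k e ≡ ed)
  isEdge⇒position isE = Any.index ed∈ , sym (Any.lookup-index ed∈)
    where ed∈ = isEdge⇒∈ isE

  matching-unique : ∀ {M x ed ed'} → IsMatching k M → ed ∈ₑ M → ed' ∈ₑ M →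
    Incident x ed → Incident x ed' → ed ≡ ed'
  matching-unique {x = x} isM (e , e∈ , refl) (e' , e'∈ , refl) inc inc' = same (e ≟ e')
    where
    same : Dec (e ≡ e') → edgeAt k e ≡ edgeAt k e'
    same (yes e≡e') = cong (edgeAt k) e≡e'
    same (no e≢e') = ⊥-elim (isM e e' e∈ e'∈ e≢e' x inc inc')

  MateAt : (V k → Edge k) → V k → Set
  MateAt μ x = Incident x (μ x) × μ (end₁ (μ x)) ≡ μ x × μ (end₂ (μ x)) ≡ μ x

  IsMateFunction : (V k → Edge k) → Set
  IsMateFunction μ = (∀ x → IsEdge (μ x)) × (∀ x → MateAt μ x)

  mateAt-intro : ∀ {μ x} ed → μ x ≡ ed → Incident x ed → μ (end₁ ed) ≡ ed → μ (end₂ ed) ≡ ed → MateAt μ x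
  mateAt-intro ed refl inc end₁-ok end₂-ok = inc , end₁-ok , end₂-ok

  mate-incident : ∀ {μ} → (∀ x → MateAt μ x) → ∀ ed → ed ≡ μ (end₁ ed) → ∀ x → Incident x ed → ed ≡ μ x
  mate-incident μ-ok ed ed≡ x (inj₁ refl) = ed≡
  mate-incident {μ} μ-ok ed ed≡ x (inj₂ refl) =
    trans ed≡ (sym (trans (cong (λ z → μ (end₂ z)) ed≡) (proj₂ (proj₂ (μ-ok (end₁ ed))))))

  selects : (V k → Edge k) → Fin (nE k) → Bool
  selects μ e = does (edgeAt k e ≟E μ (end₁ (edgeAt k e)))

  edgesOf : (V k → Edge k) → EdgeSet k
  edgesOf μ = Vec.tabulate (selects μ)

  ∈-edgesOf⁻ : ∀ {μ e} → e ∈ edgesOf μ → edgeAt k e ≡ μ (end₁ (edgeAt k e))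
  ∈-edgesOf⁻ {μ} {e} e∈ = witness (edgeAt k e ≟E μ (end₁ (edgeAt k e)))
    (trans (sym (Vec.lookup∘tabulate (selects μ) e)) (Vec.[]=⇒lookup e∈))
    where
    witness : ∀ {A : Set} (a? : Dec A) → does a? ≡ true → A
    witness (yes a) _ = a

  ∈-edgesOf⁺ : ∀ {μ e} → edgeAt k e ≡ μ (end₁ (edgeAt k e)) → e ∈ edgesOf μ
  ∈-edgesOf⁺ {μ} {e} p = Vec.lookup⇒[]= e (edgesOf μ)
    (trans (Vec.lookup∘tabulate (selects μ) e) (dec-true (edgeAt k e ≟E μ (end₁ (edgeAt k e))) p))

  mate-∈ₑ-edgesOf : ∀ {μ} → IsMateFunction μ → ∀ x → μ x ∈ₑ edgesOf μ
  mate-∈ₑ-edgesOf {μ} (μ-edge , μ-ok) x =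
    e , ∈-edgesOf⁺ {μ} {e} (trans e≡ (sym (trans (cong (λ z → μ (end₁ z)) e≡) (proj₁ (proj₂ (μ-ok x)))))) , e≡
    where
    e = proj₁ (isEdge⇒position (μ-edge x))
    e≡ = proj₂ (isEdge⇒position (μ-edge x))

  edgesOf-perfect : ∀ {μ} → IsMateFunction μ → IsPerfectMatching k (edgesOf μ)
  edgesOf-perfect {μ} isμ@(_ , μ-ok) = matching , covering
    where
    matching : IsMatching k (edgesOf μ)
    matching e e' e∈ e'∈ e≢e' x inc inc' = e≢e' (edgeAt-injective e e'
      (trans (mate-incident μ-ok _ (∈-edgesOf⁻ {μ} {e} e∈) x inc) (sym (mate-incident μ-ok _ (∈-edgesOf⁻ {μ} {e'} e'∈) x inc'))))
    covering : ∀ x → ∃[ e ] (e ∈ edgesOf μ × Incident x (edgeAt k e))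
    covering x = let (e , e∈ , e≡) = mate-∈ₑ-edgesOf {μ} isμ x in e , e∈ , subst (Incident x) (sym e≡) (proj₁ (μ-ok x))

  edgesOf-injective : ∀ {μ μ'} → IsMateFunction μ → IsMateFunction μ' → edgesOf μ ≡ edgesOf μ' → ∀ x → μ x ≡ μ' x
  edgesOf-injective {μ} {μ'} isμ isμ' eq x = matching-unique {edgesOf μ'} {x} (proj₁ (edgesOf-perfect {μ'} isμ'))
    (subst (μ x ∈ₑ_) eq (mate-∈ₑ-edgesOf {μ} isμ x)) (mate-∈ₑ-edgesOf {μ'} isμ' x)
    (proj₁ (proj₂ isμ x)) (proj₁ (proj₂ isμ' x))

  perfect≡edgesOf : ∀ {M μ} → IsMatching k M → (∀ x → μ x ∈ₑ M) → (∀ x → Incident x (μ x)) → M ≡ edgesOf μ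
  perfect≡edgesOf {M} {μ} isM μ∈M μ-inc = trans (sym (Vec.tabulate∘lookup M)) (Vec.tabulate-cong agree)
    where
    agree : ∀ e → Vec.lookup M e ≡ selects μ e
    agree e = decide (Vec.lookup M e) refl
      where
      y = end₁ (edgeAt k e)
      decide : ∀ b → Vec.lookup M e ≡ b → b ≡ selects μ e
      decide true eq = sym (dec-true (edgeAt k e ≟E μ y)
        (matching-unique {M} {y} isM (e , Vec.lookup⇒[]= e M eq , refl) (μ∈M y) (inj₁ refl) (μ-inc y)))
      decide false eq = sym (dec-false (edgeAt k e ≟E μ y) λ e≡ → e∉M (subst (_∈ M) (edgeAt-injective _ e
          (trans (proj₂ (proj₂ (μ∈M y))) (sym e≡))) (proj₁ (proj₂ (μ∈M y)))))
        where
        e∉M : ¬ e ∈ M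
        e∉M e∈ with () ← trans (sym eq) (Vec.[]=⇒lookup e∈)

  -- The eight perfect matchings

  data LocalEdge : Set where
    t-u v-t : LocalEdge
    along : ∀ {a b} → CycleEdge a b → LocalEdge

  local : Fin 4 → LocalEdge → Edge k
  local i t-u = tu i
  local i v-t = vt i
  local i (along {a} {b} _) = cycE i a b

  local-isEdge : ∀ i l → IsEdge (local i l)
  local-isEdge i t-u = outer-tu i
  local-isEdge i v-t = outer-vt i
  local-isEdge i (along e) = cycle i e

  -- external: u_i and v_i matched outside H_i; even/odd: the 12-cycle of H_i
  -- matched by its even/odd edges.
  data State : Set where
    external even odd : State

  cycleMate : State → Fin 12 → LocalEdge
  cycleMate external c0 = along e0-6
  cycleMate external c1 = along e1-2
  cycleMate external c2 = along e1-2
  cycleMate external c3 = t-u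
  cycleMate external c4 = along e4-5
  cycleMate external c5 = along e4-5
  cycleMate external c6 = along e0-6
  cycleMate external c7 = along e7-8
  cycleMate external c8 = along e7-8
  cycleMate external c9 = v-t
  cycleMate external c10 = along e10-11
  cycleMate external c11 = along e10-11
  cycleMate even c0 = along e0-1
  cycleMate even c1 = along e0-1
  cycleMate even c2 = along e2-3
  cycleMate even c3 = along e2-3
  cycleMate even c4 = along e4-5
  cycleMate even c5 = along e4-5
  cycleMate even c6 = along e6-7
  cycleMate even c7 = along e6-7
  cycleMate even c8 = along e8-9
  cycleMate even c9 = along e8-9
  cycleMate even c10 = along e10-11
  cycleMate even c11 = along e10-11
  cycleMate odd c0 = along e11-0
  cycleMate odd c1 = along e1-2
  cycleMate odd c2 = along e1-2
  cycleMate odd c3 = along e3-4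
  cycleMate odd c4 = along e3-4
  cycleMate odd c5 = along e5-6
  cycleMate odd c6 = along e5-6
  cycleMate odd c7 = along e7-8
  cycleMate odd c8 = along e7-8
  cycleMate odd c9 = along e9-10
  cycleMate odd c10 = along e9-10
  cycleMate odd c11 = along e11-0

  parity : Bool → State
  parity true = even
  parity false = odd

  parity≢external : ∀ b → ¬ parity b ≡ external
  parity≢external true ()
  parity≢external false ()

  -- (true , p , q): H₁, H₃ external and H₂, H₄ of parities p, q;
  -- (false , p , q): H₂, H₄ external and H₁, H₃ of parities p, q.
  Config : Set
  Config = Bool × Bool × Bool

  stateOf : Config → Fin 4 → State
  stateOf (true , p , q) fz = external
  stateOf (true , p , q) (fs fz) = parity p
  stateOf (true , p , q) (fs (fs fz)) = external
  stateOf (true , p , q) (fs (fs (fs fz))) = parity q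
  stateOf (false , p , q) fz = parity p
  stateOf (false , p , q) (fs fz) = external
  stateOf (false , p , q) (fs (fs fz)) = parity q
  stateOf (false , p , q) (fs (fs (fs fz))) = external

  topMate : Bool → Fin 4 → Edge k
  topMate true fz = tu (# 0)
  topMate true (fs fz) = vt (# 0)
  topMate true (fs (fs fz)) = tu (# 2)
  topMate true (fs (fs (fs fz))) = vt (# 2)
  topMate false fz = vt (# 3)
  topMate false (fs fz) = tu (# 1)
  topMate false (fs (fs fz)) = vt (# 1)
  topMate false (fs (fs (fs fz))) = tu (# 3)

  -- pathInt i r j is the path vertex v_{j+1}; it is matched to its neighbour across
  -- the edge v_{2h+1} v_{2h+2}, h = ⌊ j /2⌋.
  pathMate : Fin 4 → Fin 4 → Fin L → Edge k
  pathMate i r j = pathE i r (suc (2 * ⌊ toℕ j /2⌋))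

  mate : Config → V k → Edge k
  mate c (top t) = topMate (proj₁ c) t
  mate c (cyc i a) = local i (cycleMate (stateOf c i) a)
  mate c (pathInt i r j) = pathMate i r j
  mate c (boxA i r m) = boxMid i r m
  mate c (boxB i r m) = boxMid i r m

  external-topMate : ∀ c i → stateOf c i ≡ external → topMate (proj₁ c) i ≡ tu i × topMate (proj₁ c) (nextTop i) ≡ vt i
  external-topMate (true , p , q) fz _ = refl , refl
  external-topMate (true , p , q) (fs fz) eq = ⊥-elim (parity≢external p eq)
  external-topMate (true , p , q) (fs (fs fz)) _ = refl , refl
  external-topMate (true , p , q) (fs (fs (fs fz))) eq = ⊥-elim (parity≢external q eq)
  external-topMate (false , p , q) fz eq = ⊥-elim (parity≢external p eq)
  external-topMate (false , p , q) (fs fz) _ = refl , refl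
  external-topMate (false , p , q) (fs (fs fz)) eq = ⊥-elim (parity≢external q eq)
  external-topMate (false , p , q) (fs (fs (fs fz))) _ = refl , refl

  mate-top : ∀ c t → MateAt (mate c) (top t)
  mate-top (true , p , q) fz = inj₁ refl , refl , refl
  mate-top (true , p , q) (fs fz) = inj₂ refl , refl , refl
  mate-top (true , p , q) (fs (fs fz)) = inj₁ refl , refl , refl
  mate-top (true , p , q) (fs (fs (fs fz))) = inj₂ refl , refl , refl
  mate-top (false , p , q) fz = inj₂ refl , refl , refl
  mate-top (false , p , q) (fs fz) = inj₁ refl , refl , refl
  mate-top (false , p , q) (fs (fs fz)) = inj₂ refl , refl , refl
  mate-top (false , p , q) (fs (fs (fs fz))) = inj₁ refl , refl , refl

  mate-cyc : ∀ c i a → MateAt (mate c) (cyc i a)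
  mate-cyc c i = consistent (stateOf c i) refl
    where
    at : ∀ {s} → stateOf c i ≡ s → ∀ b → mate c (cyc i b) ≡ local i (cycleMate s b)
    at eq b = cong (λ s → local i (cycleMate s b)) eq
    consistent : ∀ s → stateOf c i ≡ s → ∀ a → MateAt (mate c) (cyc i a)
    consistent external eq c0 = mateAt-intro {mate c} _ (at eq c0) (inj₁ refl) (at eq c0) (at eq c6)
    consistent external eq c1 = mateAt-intro {mate c} _ (at eq c1) (inj₁ refl) (at eq c1) (at eq c2)
    consistent external eq c2 = mateAt-intro {mate c} _ (at eq c2) (inj₂ refl) (at eq c1) (at eq c2)
    consistent external eq c3 = mateAt-intro {mate c} _ (at eq c3) (inj₂ refl) (proj₁ (external-topMate c i eq)) (at eq c3)
    consistent external eq c4 = mateAt-intro {mate c} _ (at eq c4) (inj₁ refl) (at eq c4) (at eq c5)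
    consistent external eq c5 = mateAt-intro {mate c} _ (at eq c5) (inj₂ refl) (at eq c4) (at eq c5)
    consistent external eq c6 = mateAt-intro {mate c} _ (at eq c6) (inj₂ refl) (at eq c0) (at eq c6)
    consistent external eq c7 = mateAt-intro {mate c} _ (at eq c7) (inj₁ refl) (at eq c7) (at eq c8)
    consistent external eq c8 = mateAt-intro {mate c} _ (at eq c8) (inj₂ refl) (at eq c7) (at eq c8)
    consistent external eq c9 = mateAt-intro {mate c} _ (at eq c9) (inj₁ refl) (at eq c9) (proj₂ (external-topMate c i eq))
    consistent external eq c10 = mateAt-intro {mate c} _ (at eq c10) (inj₁ refl) (at eq c10) (at eq c11)
    consistent external eq c11 = mateAt-intro {mate c} _ (at eq c11) (inj₂ refl) (at eq c10) (at eq c11)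
    consistent even eq c0 = mateAt-intro {mate c} _ (at eq c0) (inj₁ refl) (at eq c0) (at eq c1)
    consistent even eq c1 = mateAt-intro {mate c} _ (at eq c1) (inj₂ refl) (at eq c0) (at eq c1)
    consistent even eq c2 = mateAt-intro {mate c} _ (at eq c2) (inj₁ refl) (at eq c2) (at eq c3)
    consistent even eq c3 = mateAt-intro {mate c} _ (at eq c3) (inj₂ refl) (at eq c2) (at eq c3)
    consistent even eq c4 = mateAt-intro {mate c} _ (at eq c4) (inj₁ refl) (at eq c4) (at eq c5)
    consistent even eq c5 = mateAt-intro {mate c} _ (at eq c5) (inj₂ refl) (at eq c4) (at eq c5)
    consistent even eq c6 = mateAt-intro {mate c} _ (at eq c6) (inj₁ refl) (at eq c6) (at eq c7)
    consistent even eq c7 = mateAt-intro {mate c} _ (at eq c7) (inj₂ refl) (at eq c6) (at eq c7)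
    consistent even eq c8 = mateAt-intro {mate c} _ (at eq c8) (inj₁ refl) (at eq c8) (at eq c9)
    consistent even eq c9 = mateAt-intro {mate c} _ (at eq c9) (inj₂ refl) (at eq c8) (at eq c9)
    consistent even eq c10 = mateAt-intro {mate c} _ (at eq c10) (inj₁ refl) (at eq c10) (at eq c11)
    consistent even eq c11 = mateAt-intro {mate c} _ (at eq c11) (inj₂ refl) (at eq c10) (at eq c11)
    consistent odd eq c0 = mateAt-intro {mate c} _ (at eq c0) (inj₂ refl) (at eq c11) (at eq c0)
    consistent odd eq c1 = mateAt-intro {mate c} _ (at eq c1) (inj₁ refl) (at eq c1) (at eq c2)
    consistent odd eq c2 = mateAt-intro {mate c} _ (at eq c2) (inj₂ refl) (at eq c1) (at eq c2)
    consistent odd eq c3 = mateAt-intro {mate c} _ (at eq c3) (inj₁ refl) (at eq c3) (at eq c4)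
    consistent odd eq c4 = mateAt-intro {mate c} _ (at eq c4) (inj₂ refl) (at eq c3) (at eq c4)
    consistent odd eq c5 = mateAt-intro {mate c} _ (at eq c5) (inj₁ refl) (at eq c5) (at eq c6)
    consistent odd eq c6 = mateAt-intro {mate c} _ (at eq c6) (inj₂ refl) (at eq c5) (at eq c6)
    consistent odd eq c7 = mateAt-intro {mate c} _ (at eq c7) (inj₁ refl) (at eq c7) (at eq c8)
    consistent odd eq c8 = mateAt-intro {mate c} _ (at eq c8) (inj₂ refl) (at eq c7) (at eq c8)
    consistent odd eq c9 = mateAt-intro {mate c} _ (at eq c9) (inj₁ refl) (at eq c9) (at eq c10)
    consistent odd eq c10 = mateAt-intro {mate c} _ (at eq c10) (inj₂ refl) (at eq c9) (at eq c10)
    consistent odd eq c11 = mateAt-intro {mate c} _ (at eq c11) (inj₁ refl) (at eq c11) (at eq c0)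

  mate-chainV : ∀ c {i r n} (p : n < L) → mate c (chainV i r (suc n)) ≡ pathE i r (suc (2 * ⌊ n /2⌋))
  mate-chainV c {i} {r} p = trans (cong (mate c) (chainV-internal p))
    (cong (λ z → pathE i r (suc (2 * ⌊ z /2⌋))) (toℕ-fromℕ< p))

  ⌊j/2⌋<k : ∀ (j : Fin L) → suc ⌊ toℕ j /2⌋ < k
  ⌊j/2⌋<k j = s≤s (*-cancelˡ-< 2 _ k' (subst (2 * ⌊ toℕ j /2⌋ <_) L≡ (<-≤-trans (s≤s (2*⌊n/2⌋≤n (toℕ j))) (toℕ<n j))))

  pathMate-bound : ∀ (j : Fin L) → suc (2 * ⌊ toℕ j /2⌋) < L
  pathMate-bound j = 1+2n<L (⌊j/2⌋<k j)

  mate-path : ∀ c i r j → MateAt (mate c) (pathInt i r j)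
  mate-path c i r j = incident (even-or-odd n) ,
    trans (mate-chainV c (<-trans (n<1+n _) (pathMate-bound j))) (cong (λ z → pathE i r (suc (2 * z))) (⌊2*n/2⌋≡n h)) ,
    trans (mate-chainV c (pathMate-bound j)) (cong (λ z → pathE i r (suc (2 * z))) (⌊1+2*n/2⌋≡n h))
    where
    n = toℕ j
    h = ⌊ n /2⌋
    incident : n ≡ 2 * h ⊎ n ≡ suc (2 * h) → Incident (pathInt i r j) (pathE i r (suc (2 * h)))
    incident (inj₁ eq) = inj₁ (trans (cong (λ z → chainV i r (suc z)) (sym eq)) (chainV≡pathInt-toℕ j))
    incident (inj₂ eq) = inj₂ (trans (cong (λ z → chainV i r (suc z)) (sym eq)) (chainV≡pathInt-toℕ j))

  mate-at : ∀ c x → MateAt (mate c) x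
  mate-at c (top t) = mate-top c t
  mate-at c (cyc i a) = mate-cyc c i a
  mate-at c (pathInt i r j) = mate-path c i r j
  mate-at c (boxA i r m) = inj₁ refl , refl , refl
  mate-at c (boxB i r m) = inj₂ refl , refl , refl

  topMate-isEdge : ∀ b t → IsEdge (topMate b t)
  topMate-isEdge true fz = outer-tu _
  topMate-isEdge true (fs fz) = outer-vt _
  topMate-isEdge true (fs (fs fz)) = outer-tu _
  topMate-isEdge true (fs (fs (fs fz))) = outer-vt _
  topMate-isEdge false fz = outer-vt _
  topMate-isEdge false (fs fz) = outer-tu _
  topMate-isEdge false (fs (fs fz)) = outer-vt _
  topMate-isEdge false (fs (fs (fs fz))) = outer-tu _

  mate-isMateFunction : ∀ c → IsMateFunction (mate c)
  mate-isMateFunction c = isEdge , mate-at c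
    where
    isEdge : ∀ x → IsEdge (mate c x)
    isEdge (top t) = topMate-isEdge (proj₁ c) t
    isEdge (cyc i a) = local-isEdge i (cycleMate (stateOf c i) a)
    isEdge (pathInt i r j) = chain i r (path _ (m≤n⇒m≤1+n (pathMate-bound j)))
    isEdge (boxA i r m) = chain i r (mid m)
    isEdge (boxB i r m) = chain i r (mid m)

  matchingOf : Config → EdgeSet k
  matchingOf c = edgesOf (mate c)

  matchingOf-perfect : ∀ c → IsPerfectMatching k (matchingOf c)
  matchingOf-perfect c = edgesOf-perfect {mate c} (mate-isMateFunction c)

  covered-by-mate : ∀ c i x → owner (mate c x) ≡ just i → CoveredInH k i (matchingOf c) x
  covered-by-mate c i x own = e , e∈ , trans (cong owner e≡) own , subst (Incident x) (sym e≡) (proj₁ (mate-at c x))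
    where
    e = proj₁ (mate-∈ₑ-edgesOf {mate c} (mate-isMateFunction c) x)
    e∈ = proj₁ (proj₂ (mate-∈ₑ-edgesOf {mate c} (mate-isMateFunction c) x))
    e≡ = proj₂ (proj₂ (mate-∈ₑ-edgesOf {mate c} (mate-isMateFunction c) x))

  covered⇒mate-owner : ∀ c i x → CoveredInH k i (matchingOf c) x → owner (mate c x) ≡ just i
  covered⇒mate-owner c i x (e , e∈ , own , inc) =
    trans (cong owner (sym (mate-incident (mate-at c) _ (∈-edgesOf⁻ {mate c} {e} e∈) x inc))) own

  external-owner : ∀ i a → ¬ (cyc {k} i a ≡ uV i ⊎ cyc {k} i a ≡ vV i) → owner (local i (cycleMate external a)) ≡ just i
  external-owner i c0 _ = refl
  external-owner i c1 _ = refl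
  external-owner i c2 _ = refl
  external-owner i c3 ¬uv = ⊥-elim (¬uv (inj₁ refl))
  external-owner i c4 _ = refl
  external-owner i c5 _ = refl
  external-owner i c6 _ = refl
  external-owner i c7 _ = refl
  external-owner i c8 _ = refl
  external-owner i c9 ¬uv = ⊥-elim (¬uv (inj₂ refl))
  external-owner i c10 _ = refl
  external-owner i c11 _ = refl

  S-external : ∀ c i → stateOf c i ≡ external → S k i (matchingOf c)
  S-external c i eq x x∈H = uncovered x , covered x x∈H
    where
    nothing≢just : ¬ nothing ≡ just i
    nothing≢just ()
    uncovered : ∀ x → x ≡ uV i ⊎ x ≡ vV i → ¬ CoveredInH k i (matchingOf c) x
    uncovered x (inj₁ refl) cov = nothing≢just
      (trans (cong (λ s → owner (local i (cycleMate s c3))) (sym eq)) (covered⇒mate-owner c i x cov))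
    uncovered x (inj₂ refl) cov = nothing≢just
      (trans (cong (λ s → owner (local i (cycleMate s c9))) (sym eq)) (covered⇒mate-owner c i x cov))
    covered : ∀ x → InH i x → ¬ (x ≡ uV i ⊎ x ≡ vV i) → CoveredInH k i (matchingOf c) x
    covered (cyc i a) refl ¬uv =
      covered-by-mate c i _ (trans (cong (λ s → owner (local i (cycleMate s a))) eq) (external-owner i a ¬uv))
    covered (pathInt i r j) refl _ = covered-by-mate c i _ refl
    covered (boxA i r m) refl _ = covered-by-mate c i _ refl
    covered (boxB i r m) refl _ = covered-by-mate c i _ refl

  ¬S-parity : ∀ c i b → stateOf c i ≡ parity b → ¬ S k i (matchingOf c)
  ¬S-parity c i b eq Si = proj₁ (Si (uV i) refl) (inj₁ refl)
    (covered-by-mate c i (uV i) (trans (cong (λ s → owner (local i (cycleMate s c3))) eq) (internal-owner b)))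
    where
    internal-owner : ∀ b → owner (local i (cycleMate (parity b) c3)) ≡ just i
    internal-owner true = refl
    internal-owner false = refl

  decodeConfig : Bool → Bool → Bool → Bool → Bool → Config
  decodeConfig true _ e₁ _ e₃ = true , e₁ , e₃
  decodeConfig false e₀ _ e₂ _ = false , e₀ , e₂

  readConfig : (V k → Edge k) → Config
  readConfig μ = decodeConfig (does (μ (top (# 0)) ≟E tu (# 0)))
    (evenAt (# 0)) (evenAt (# 1)) (evenAt (# 2)) (evenAt (# 3))
    where
    evenAt : Fin 4 → Bool
    evenAt i = does (μ (cyc i c0) ≟E cycE i c0 c1)

  readConfig-mate : ∀ c → readConfig (mate c) ≡ c
  readConfig-mate (true , true , true) = refl
  readConfig-mate (true , true , false) = refl
  readConfig-mate (true , false , true) = refl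
  readConfig-mate (true , false , false) = refl
  readConfig-mate (false , true , true) = refl
  readConfig-mate (false , true , false) = refl
  readConfig-mate (false , false , true) = refl
  readConfig-mate (false , false , false) = refl

  readConfig-cong : ∀ {μ μ'} → (∀ x → μ x ≡ μ' x) → readConfig μ ≡ readConfig μ'
  readConfig-cong eq rewrite eq (top (# 0)) | eq (cyc (# 0) c0) | eq (cyc (# 1) c0) | eq (cyc (# 2) c0) | eq (cyc (# 3) c0) = refl

  matchingOf-injective : ∀ {c c'} → matchingOf c ≡ matchingOf c' → c ≡ c'
  matchingOf-injective {c} {c'} eq = begin
    c                    ≡⟨ sym (readConfig-mate c) ⟩
    readConfig (mate c)  ≡⟨ readConfig-cong (edgesOf-injective {mate c} {mate c'} (mate-isMateFunction c) (mate-isMateFunction c') eq) ⟩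
    readConfig (mate c') ≡⟨ readConfig-mate c' ⟩
    c'                   ∎
    where open ≡-Reasoning

  -- Every perfect matching is one of them

  module Structure (M : EdgeSet k) (pm : IsPerfectMatching k M) where

    exclusive : ∀ {x ed ed'} → ed ∈ₑ M → ed' ∈ₑ M → ¬ ed ≡ ed' → Incident x ed → Incident x ed' → ⊥
    exclusive {x} ed∈ ed'∈ ed≢ed' inc inc' = ed≢ed' (matching-unique {M} {x} (proj₁ pm) ed∈ ed'∈ inc inc')

    excludes : ∀ {x ed ed'} → ed ∈ₑ M → Incident x ed → Incident x ed' → ¬ ed ≡ ed' → ¬ ed' ∈ₑ M
    excludes ed∈ inc inc' ed≢ed' ed'∈ = exclusive ed∈ ed'∈ ed≢ed' inc inc'

    MatchedAt : V k → Set
    MatchedAt x = ∃[ ed ] (ed ∈ₑ M × IsEdge ed × Incident x ed)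

    matched : ∀ x → MatchedAt x
    matched x = let (e , e∈ , inc) = proj₂ pm x in edgeAt k e , (e , e∈ , refl) , edgeAt-isEdge e , inc

    ChainMatched : Fin 4 → Fin 4 → ℕ → Set
    ChainMatched i r J = ∃[ ed ] (ed ∈ₑ M × ChainEdge i r ed × Incident (chainV i r J) ed)

    module Chain (i r : Fin 4) where

      BoxEntered : ∀ n → n < k → Set
      BoxEntered n p = boxEntry i r (fromℕ< p) ∈ₑ M ⊎ pathE i r (2 * n) ∈ₑ M

      entered-box-covers-exit : ∀ n (p : n < k) → BoxEntered n p → ∀ {ed} → ed ∈ₑ M →
        Incident (chainV i r (suc (2 * n))) ed → ¬ ed ≡ pathE i r (2 * n) → ¬ ed ≡ boxExit i r (fromℕ< p) → ⊥
      entered-box-covers-exit n p (inj₂ path∈) ed∈ inc ≢path ≢exit = exclusive path∈ ed∈ (λ eq → ≢path (sym eq)) (inj₂ refl) inc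
      entered-box-covers-exit n p (inj₁ entry∈) {ed} ed∈ inc ≢path ≢exit = at-b (matched (boxB i r m))
        where
        m = fromℕ< p
        at-b : MatchedAt (boxB i r m) → ⊥
        at-b (ed' , ed'∈ , isE , inc') = by-cases (incident-boxB isE inc') ed'∈
          where
          by-cases : ∀ {ed'} → ed' ≡ boxMid i r m ⊎ ed' ≡ boxExit i r m → ed' ∈ₑ M → ⊥
          by-cases (inj₁ refl) ed'∈ = exclusive entry∈ ed'∈ (λ ()) (inj₂ refl) (inj₁ refl)
          by-cases (inj₂ refl) ed'∈ = exclusive ed'∈ ed∈ (λ eq → ≢exit (sym eq))
            (inj₂ (cong (λ z → chainV i r (suc (2 * z))) (toℕ-fromℕ< p))) inc

      enter-next : ∀ n (p : n < k) (p' : suc n < k) → BoxEntered n p → BoxEntered (suc n) p'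
      enter-next n p p' entered = at-next (matched (chainV i r (suc (suc (2 * n)))))
        where
        path≢path : ¬ pathE i r (suc (2 * n)) ≡ pathE i r (2 * n)
        path≢path eq = 1+n≢n (sym (trans e (cong suc (toℕ-fromℕ< (2n<L p')))))
          where e = proj₂ (proj₂ (chainV≡pathInt {i} {r} {2 * n} (trans (sym (cong end₁ eq)) (chainV-internal (2n<L p')))))
        at-next : MatchedAt (chainV i r (suc (suc (2 * n)))) → BoxEntered (suc n) p'
        at-next (ed , ed∈ , isE , inc) = by-cases (incident-chainV {i} {r} {suc (2 * n)} (1+2n<L p') isE inc) ed∈
          where
          by-cases : ∀ {ed} → PathStar i r (suc (2 * n)) ed → ed ∈ₑ M → BoxEntered (suc n) p'
          by-cases (inj₁ refl) ed∈ = ⊥-elim (entered-box-covers-exit n p entered ed∈ (inj₁ refl) path≢path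
                                       (λ eq → chainV≢boxB {i} {r} {suc (2 * n)} (cong end₁ eq)))
          by-cases (inj₂ (inj₁ refl)) ed∈ = inj₂ (subst (λ z → pathE i r z ∈ₑ M) (sym (*-suc 2 n)) ed∈)
          by-cases (inj₂ (inj₂ (inj₁ (m , e , refl)))) ed∈ = inj₁ (subst (λ z → boxEntry i r z ∈ₑ M)
            (toℕ-injective (trans (*-cancelˡ-≡ (toℕ m) (suc n) 2 (trans e (sym (*-suc 2 n)))) (sym (toℕ-fromℕ< p')))) ed∈)
          by-cases (inj₂ (inj₂ (inj₂ (m , e , refl)))) _ = ⊥-elim (even≢odd (toℕ m) n e)

      enter-first : ChainMatched i r 0 → BoxEntered 0 (s≤s z≤n)
      enter-first (ed , ed∈ , path J _ , inj₁ eq) = inj₂ (subst (λ z → pathE i r z ∈ₑ M) (chainV≡start {i} {r} {J} eq) ed∈)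
      enter-first (ed , ed∈ , path J _ , inj₂ eq) = ⊥-elim (0≢1+n (sym (chainV≡start {i} {r} {suc J} eq)))
      enter-first (ed , ed∈ , entry m , inj₁ eq) = inj₁ (subst (λ z → boxEntry i r z ∈ₑ M)
        (toℕ-injective (*-cancelˡ-≡ (toℕ m) 0 2 (chainV≡start {i} {r} {2 * toℕ m} eq))) ed∈)
      enter-first (ed , ed∈ , entry m , inj₂ ())
      enter-first (ed , ed∈ , mid m , inj₁ ())
      enter-first (ed , ed∈ , mid m , inj₂ ())
      enter-first (ed , ed∈ , exit m , inj₁ ())
      enter-first (ed , ed∈ , exit m , inj₂ eq) = ⊥-elim (0≢1+n (sym (chainV≡start {i} {r} {suc (2 * toℕ m)} eq)))

      exit-last : ∀ n (p : n < k) → n ≡ k' → BoxEntered n p → ChainMatched i r (suc L)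
      exit-last n p refl (inj₂ path∈) = _ , path∈ , path (2 * n) (s≤s (≤-reflexive (sym L≡))) ,
        inj₂ (cong (λ z → chainV i r (suc z)) (sym L≡))
      exit-last n p refl (inj₁ entry∈) = at-b (matched (boxB i r (fromℕ< p)))
        where
        at-b : MatchedAt (boxB i r (fromℕ< p)) → ChainMatched i r (suc L)
        at-b (ed , ed∈ , isE , inc) = by-cases (incident-boxB isE inc) ed∈
          where
          by-cases : ∀ {ed} → ed ≡ boxMid i r (fromℕ< p) ⊎ ed ≡ boxExit i r (fromℕ< p) → ed ∈ₑ M → ChainMatched i r (suc L)
          by-cases (inj₁ refl) ed∈ = ⊥-elim (exclusive entry∈ ed∈ (λ ()) (inj₂ refl) (inj₁ refl))
          by-cases (inj₂ refl) ed∈ = _ , ed∈ , exit _ ,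
            inj₂ (cong (λ z → chainV i r (suc z)) (trans (cong (2 *_) (toℕ-fromℕ< p)) (sym L≡)))

      entered-from : ∀ d n (p : n < k) → d + n ≡ k' → BoxEntered n p → ChainMatched i r (suc L)
      entered-from zero n p eq entered = exit-last n p eq entered
      entered-from (suc d) n p eq entered = entered-from d (suc n) p' (trans (+-suc d n) eq) (enter-next n p p' entered)
        where
        p' : suc n < k
        p' = s≤s (subst (suc n ≤_) eq (s≤s (m≤n+m n d)))

      entered⇒exits : ChainMatched i r 0 → ChainMatched i r (suc L)
      entered⇒exits entered = entered-from k' 0 (s≤s z≤n) (+-identityʳ k') (enter-first entered)

      module Idle (idle : ¬ ChainMatched i r 0) where

        NotEntered : ∀ n → n < k → Set
        NotEntered n p = ¬ boxEntry i r (fromℕ< p) ∈ₑ M × ¬ pathE i r (2 * n) ∈ₑ M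

        boxMid-∈⁺ : ∀ {m} → ¬ boxEntry i r m ∈ₑ M → boxMid i r m ∈ₑ M
        boxMid-∈⁺ {m} entry∉ = at-a (matched (boxA i r m))
          where
          at-a : MatchedAt (boxA i r m) → boxMid i r m ∈ₑ M
          at-a (ed , ed∈ , isE , inc) = by-cases (incident-boxA isE inc) ed∈
            where
            by-cases : ∀ {ed} → ed ≡ boxEntry i r m ⊎ ed ≡ boxMid i r m → ed ∈ₑ M → boxMid i r m ∈ₑ M
            by-cases (inj₁ refl) ed∈ = ⊥-elim (entry∉ ed∈)
            by-cases (inj₂ refl) ed∈ = ed∈

        leave-box : ∀ n (p : n < k) → NotEntered n p → suc n < k → pathE i r (suc (2 * n)) ∈ₑ M
        leave-box n p (entry∉ , path∉) p' = at-odd (matched (chainV i r (suc (2 * n))))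
          where
          at-odd : MatchedAt (chainV i r (suc (2 * n))) → pathE i r (suc (2 * n)) ∈ₑ M
          at-odd (ed , ed∈ , isE , inc) = by-cases (incident-chainV {i} {r} {2 * n} (2n<L p') isE inc) ed∈
            where
            by-cases : ∀ {ed} → PathStar i r (2 * n) ed → ed ∈ₑ M → pathE i r (suc (2 * n)) ∈ₑ M
            by-cases (inj₁ refl) ed∈ = ⊥-elim (path∉ ed∈)
            by-cases (inj₂ (inj₁ refl)) ed∈ = ed∈
            by-cases (inj₂ (inj₂ (inj₁ (m , e , refl)))) _ = ⊥-elim (even≢odd (toℕ m) n e)
            by-cases (inj₂ (inj₂ (inj₂ (m , e , refl)))) ed∈ = ⊥-elim (exclusive ed∈ mid∈ (λ ()) (inj₁ refl) (inj₂ refl))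
              where
              m≡ : m ≡ fromℕ< p
              m≡ = toℕ-injective (trans (*-cancelˡ-≡ (toℕ m) n 2 e) (sym (toℕ-fromℕ< p)))
              mid∈ : boxMid i r m ∈ₑ M
              mid∈ = subst (λ z → boxMid i r z ∈ₑ M) (sym m≡) (boxMid-∈⁺ entry∉)

        not-entered : ∀ n (p : n < k) → NotEntered n p
        not-entered zero p =
          (λ ed∈ → idle (_ , ed∈ , entry _ , inj₁ (cong (λ z → chainV i r (2 * z)) (toℕ-fromℕ< p)))) ,
          (λ ed∈ → idle (_ , ed∈ , path 0 (s≤s z≤n) , inj₁ refl))
        not-entered (suc n) p = entry∉ , path∉
          where
          p' : n < k
          p' = <-trans (n<1+n n) p
          left∈ : pathE i r (suc (2 * n)) ∈ₑ M
          left∈ = leave-box n p' (not-entered n p') p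
          v≡ : chainV i r (suc (suc (2 * n))) ≡ chainV i r (2 * suc n)
          v≡ = cong (chainV i r) (sym (*-suc 2 n))
          entry∉ : ¬ boxEntry i r (fromℕ< p) ∈ₑ M
          entry∉ ed∈ = exclusive ed∈ left∈ (λ eq → chainV≢boxA {i} {r} {suc (suc (2 * n))} (sym (cong end₂ eq)))
            (inj₁ (cong (λ z → chainV i r (2 * z)) (toℕ-fromℕ< p))) (inj₂ v≡)
          path≢left : ¬ pathE i r (2 * suc n) ≡ pathE i r (suc (2 * n))
          path≢left eq = 1+n≢n (trans (sym (*-suc 2 n)) (trans e (cong suc (toℕ-fromℕ< (2n<L p)))))
            where e = proj₂ (proj₂ (chainV≡pathInt {i} {r} {2 * suc n} (trans (cong end₁ eq) (chainV-internal (2n<L p)))))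
          path∉ : ¬ pathE i r (2 * suc n) ∈ₑ M
          path∉ ed∈ = exclusive ed∈ left∈ path≢left (inj₁ refl) (inj₂ v≡)

        boxMid-∈ : ∀ m → boxMid i r m ∈ₑ M
        boxMid-∈ m = boxMid-∈⁺ (subst (λ z → ¬ boxEntry i r z ∈ₑ M) (fromℕ<-toℕ m (toℕ<n m))
          (proj₁ (not-entered (toℕ m) (toℕ<n m))))

        pathE-odd-∈ : ∀ n → suc n < k → pathE i r (suc (2 * n)) ∈ₑ M
        pathE-odd-∈ n p' = leave-box n p (not-entered n p) p'
          where
          p : n < k
          p = <-trans (n<1+n n) p'

        not-exits : ¬ ChainMatched i r (suc L)
        not-exits (ed , ed∈ , path J lt , inj₁ eq) = <-irrefl refl (≤-trans lt (chainV≡end {i} {r} {J} eq))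
        not-exits (ed , ed∈ , path J lt , inj₂ eq) = proj₂ (not-entered k' (n<1+n k'))
          (subst (λ z → pathE i r z ∈ₑ M) (trans (≤-antisym (≤-pred lt) (≤-pred (chainV≡end {i} {r} {suc J} eq))) L≡) ed∈)
        not-exits (ed , ed∈ , entry m , inj₁ eq) = <-irrefl refl (≤-trans (s≤s (2m≤L m)) (chainV≡end {i} {r} {2 * toℕ m} eq))
        not-exits (ed , ed∈ , entry m , inj₂ eq) = chainV≢boxA {i} {r} {suc L} (sym eq)
        not-exits (ed , ed∈ , mid m , inj₁ eq) = chainV≢boxA {i} {r} {suc L} (sym eq)
        not-exits (ed , ed∈ , mid m , inj₂ eq) = chainV≢boxB {i} {r} {suc L} (sym eq)
        not-exits (ed , ed∈ , exit m , inj₁ eq) = chainV≢boxB {i} {r} {suc L} (sym eq)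
        not-exits (ed , ed∈ , exit m , inj₂ eq) = exclusive ed∈ (boxMid-∈ m) (λ ()) (inj₁ refl) (inj₂ refl)

    CycleMatched : Fin 4 → Fin 12 → Set
    CycleMatched i a = ∃[ ed ] (ed ∈ₑ M × ed List.∈ cycleStar i (toℕ a))

    chain-ends-even : ∀ r → toℕ (chainStart r) ≡ 2 * ⌊ toℕ (chainStart r) /2⌋ × toℕ (chainEnd r) ≡ 2 * ⌊ toℕ (chainEnd r) /2⌋
    chain-ends-even fz = refl , refl
    chain-ends-even (fs fz) = refl , refl
    chain-ends-even (fs (fs fz)) = refl , refl
    chain-ends-even (fs (fs (fs fz))) = refl , refl

    odd-matched : ∀ i a → toℕ a ≡ suc (2 * ⌊ toℕ a /2⌋) → CycleMatched i a
    odd-matched i a a-odd = at-a (matched (cyc i a))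
      where
      not-even : ∀ {b} → a ≡ b → toℕ b ≡ 2 * ⌊ toℕ b /2⌋ → ⊥
      not-even refl b-even = even≢odd ⌊ toℕ a /2⌋ ⌊ toℕ a /2⌋ (trans (sym b-even) a-odd)
      at-a : MatchedAt (cyc i a) → CycleMatched i a
      at-a (ed , ed∈ , isE , inc) = by-cases (incident-cyc isE inc)
        where
        by-cases : ed List.∈ cycleStar i (toℕ a) ⊎ ChainEndAt i a ed → CycleMatched i a
        by-cases (inj₁ ed∈star) = ed , ed∈ , ed∈star
        by-cases (inj₂ (r , _ , inj₁ (_ , a≡))) = ⊥-elim (not-even a≡ (proj₁ (chain-ends-even r)))
        by-cases (inj₂ (r , _ , inj₂ (_ , a≡))) = ⊥-elim (not-even a≡ (proj₂ (chain-ends-even r)))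

    cycleEdge-blocks : ∀ {i r a b J} → cycE i a b ∈ₑ M → CycleEdge a b → Incident (chainV i r J) (cycE i a b) → ¬ ChainMatched i r J
    cycleEdge-blocks cyc∈ e inc (ed , ed∈ , c , inc') = exclusive ed∈ cyc∈ (λ eq → chainEdge≢cycleEdge c eq e) inc' inc

    -- The odd neighbour of a chain endpoint is matched along the cycle, occupying
    -- either the entry or the exit of the chain; an entered chain would need both.
    chain-idle : ∀ i r → ¬ ChainMatched i r 0
    chain-idle i fz = by-cases (odd-matched i c1 refl)
      where
      by-cases : CycleMatched i c1 → ¬ ChainMatched i fz 0
      by-cases (_ , ed∈ , here refl) entered = cycleEdge-blocks {J = suc L} ed∈ e0-1 (inj₁ (sym chainV-last)) (Chain.entered⇒exits i fz entered)
      by-cases (_ , ed∈ , there (here refl)) = cycleEdge-blocks {J = 0} ed∈ e1-2 (inj₂ refl)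
    chain-idle i (fs fz) = by-cases (odd-matched i c11 refl)
      where
      by-cases : CycleMatched i c11 → ¬ ChainMatched i (fs fz) 0
      by-cases (_ , ed∈ , here refl) entered = cycleEdge-blocks {J = suc L} ed∈ e10-11 (inj₁ (sym chainV-last)) (Chain.entered⇒exits i (fs fz) entered)
      by-cases (_ , ed∈ , there (here refl)) = cycleEdge-blocks {J = 0} ed∈ e11-0 (inj₂ refl)
    chain-idle i (fs (fs fz)) = by-cases (odd-matched i c5 refl)
      where
      by-cases : CycleMatched i c5 → ¬ ChainMatched i (fs (fs fz)) 0
      by-cases (_ , ed∈ , here refl) = cycleEdge-blocks {J = 0} ed∈ e4-5 (inj₁ refl)
      by-cases (_ , ed∈ , there (here refl)) entered = cycleEdge-blocks {J = suc L} ed∈ e5-6 (inj₂ (sym chainV-last)) (Chain.entered⇒exits i (fs (fs fz)) entered)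
    chain-idle i (fs (fs (fs fz))) = by-cases (odd-matched i c7 refl)
      where
      by-cases : CycleMatched i c7 → ¬ ChainMatched i (fs (fs (fs fz))) 0
      by-cases (_ , ed∈ , here refl) = cycleEdge-blocks {J = 0} ed∈ e6-7 (inj₁ refl)
      by-cases (_ , ed∈ , there (here refl)) entered = cycleEdge-blocks {J = suc L} ed∈ e7-8 (inj₂ (sym chainV-last)) (Chain.entered⇒exits i (fs (fs (fs fz))) entered)

    cycle-matched : ∀ i a → CycleMatched i a
    cycle-matched i a = at-a (matched (cyc i a))
      where
      at-a : MatchedAt (cyc i a) → CycleMatched i a
      at-a (ed , ed∈ , isE , inc) = by-cases (incident-cyc isE inc)
        where
        by-cases : ed List.∈ cycleStar i (toℕ a) ⊎ ChainEndAt i a ed → CycleMatched i a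
        by-cases (inj₁ ed∈star) = ed , ed∈ , ed∈star
        by-cases (inj₂ (r , c , inj₁ (inc' , _))) = ⊥-elim (chain-idle i r (ed , ed∈ , c , inc'))
        by-cases (inj₂ (r , c , inj₂ (inc' , _))) = ⊥-elim (Chain.Idle.not-exits i r (chain-idle i r) (ed , ed∈ , c , inc'))

    one-of-two : ∀ {e₁ e₂ ed} → ed ∈ₑ M → ed List.∈ (e₁ ∷ e₂ ∷ []) → e₁ ∈ₑ M ⊎ e₂ ∈ₑ M
    one-of-two ed∈ (here refl) = inj₁ ed∈
    one-of-two ed∈ (there (here refl)) = inj₂ ed∈

    one-of-three : ∀ {e₁ e₂ e₃ ed} → ed ∈ₑ M → ed List.∈ (e₁ ∷ e₂ ∷ e₃ ∷ []) → e₁ ∈ₑ M ⊎ e₂ ∈ₑ M ⊎ e₃ ∈ₑ M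
    one-of-three ed∈ (here refl) = inj₁ ed∈
    one-of-three ed∈ (there (here refl)) = inj₂ (inj₁ ed∈)
    one-of-three ed∈ (there (there (here refl))) = inj₂ (inj₂ ed∈)

    data CycleState (i : Fin 4) : Set where
      external-state : tu i ∈ₑ M → vt i ∈ₑ M → cycE i c1 c2 ∈ₑ M → cycE i c4 c5 ∈ₑ M →
        cycE i c7 c8 ∈ₑ M → cycE i c10 c11 ∈ₑ M → cycE i c0 c6 ∈ₑ M → CycleState i
      even-state : ¬ tu i ∈ₑ M → ¬ vt i ∈ₑ M → cycE i c0 c1 ∈ₑ M → cycE i c2 c3 ∈ₑ M →
        cycE i c4 c5 ∈ₑ M → cycE i c6 c7 ∈ₑ M → cycE i c8 c9 ∈ₑ M → cycE i c10 c11 ∈ₑ M → CycleState i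
      odd-state : ¬ tu i ∈ₑ M → ¬ vt i ∈ₑ M → cycE i c1 c2 ∈ₑ M → cycE i c3 c4 ∈ₑ M →
        cycE i c5 c6 ∈ₑ M → cycE i c7 c8 ∈ₑ M → cycE i c9 c10 ∈ₑ M → cycE i c11 c0 ∈ₑ M → CycleState i

    -- With all chains idle, the matching edge at u_i = c3 determines the rest.
    cycleState : ∀ i → CycleState i
    cycleState i = at-c3 (star c3)
      where
      star : ∀ a → CycleMatched i a
      star = cycle-matched i
      two : ∀ a {e₁ e₂} → cycleStar i (toℕ a) ≡ e₁ ∷ e₂ ∷ [] → e₁ ∈ₑ M ⊎ e₂ ∈ₑ M
      two a eq = let m = star a in one-of-two (proj₁ (proj₂ m)) (subst (proj₁ m List.∈_) eq (proj₂ (proj₂ m)))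
      three : ∀ a {e₁ e₂ e₃} → cycleStar i (toℕ a) ≡ e₁ ∷ e₂ ∷ e₃ ∷ [] → e₁ ∈ₑ M ⊎ e₂ ∈ₑ M ⊎ e₃ ∈ₑ M
      three a eq = let m = star a in one-of-three (proj₁ (proj₂ m)) (subst (proj₁ m List.∈_) eq (proj₂ (proj₂ m)))

      at-c3 : CycleMatched i c3 → CycleState i
      at-c3 (_ , m∈ , here refl) = even-state ¬mtu ¬mvt m0-1 m∈ m4-5 m6-7 m8-9 m10-11
        where
        ¬mtu = excludes m∈ (inj₂ refl) (inj₂ refl) (λ ())
        m0-1 = resolve₁ (two c1 refl) (excludes m∈ (inj₁ refl) (inj₂ refl) (λ ()))
        m4-5 = resolve₂ (two c4 refl) (excludes m∈ (inj₂ refl) (inj₁ refl) (λ ()))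
        m6-7 = resolve₁ (resolve₂ (three c6 refl) (excludes m4-5 (inj₂ refl) (inj₁ refl) (λ ())))
                        (excludes m0-1 (inj₁ refl) (inj₁ refl) (λ ()))
        m8-9 = resolve₂ (two c8 refl) (excludes m6-7 (inj₂ refl) (inj₁ refl) (λ ()))
        ¬mvt = excludes m8-9 (inj₂ refl) (inj₁ refl) (λ ())
        m10-11 = resolve₂ (two c10 refl) (excludes m8-9 (inj₂ refl) (inj₁ refl) (λ ()))
      at-c3 (_ , m∈ , there (here refl)) = odd-state ¬mtu ¬mvt m1-2 m∈ m5-6 m7-8 m9-10 m11-0
        where
        ¬mtu = excludes m∈ (inj₁ refl) (inj₂ refl) (λ ())
        m1-2 = resolve₁ (two c2 refl) (excludes m∈ (inj₁ refl) (inj₂ refl) (λ ()))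
        m5-6 = resolve₂ (two c5 refl) (excludes m∈ (inj₂ refl) (inj₁ refl) (λ ()))
        m7-8 = resolve₂ (two c7 refl) (excludes m5-6 (inj₂ refl) (inj₁ refl) (λ ()))
        m11-0 = resolve₁ (three c0 refl) λ { (inj₁ m0-1) → excludes m1-2 (inj₁ refl) (inj₂ refl) (λ ()) m0-1
                                           ; (inj₂ m0-6) → excludes m5-6 (inj₂ refl) (inj₂ refl) (λ ()) m0-6 }
        m9-10 = resolve₁ (two c10 refl) (excludes m11-0 (inj₁ refl) (inj₂ refl) (λ ()))
        ¬mvt = excludes m9-10 (inj₁ refl) (inj₁ refl) (λ ())
      at-c3 (_ , mtu , there (there (here refl))) = at-c6 (three c6 refl)
        where
        m1-2 = resolve₁ (two c2 refl) (excludes mtu (inj₂ refl) (inj₂ refl) (λ ()))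
        m4-5 = resolve₂ (two c4 refl) (excludes mtu (inj₂ refl) (inj₁ refl) (λ ()))
        ¬m0-1 = excludes m1-2 (inj₁ refl) (inj₂ refl) (λ ())
        ¬m5-6 = excludes m4-5 (inj₂ refl) (inj₁ refl) (λ ())
        at-c6 : cycE i c5 c6 ∈ₑ M ⊎ cycE i c6 c7 ∈ₑ M ⊎ cycE i c0 c6 ∈ₑ M → CycleState i
        at-c6 (inj₁ m5-6) = ⊥-elim (¬m5-6 m5-6)
        at-c6 (inj₂ (inj₁ m6-7)) = ⊥-elim (exclusive m6-7 m0-6 (λ ()) (inj₁ refl) (inj₂ refl))
          where
          m8-9 = resolve₂ (two c8 refl) (excludes m6-7 (inj₂ refl) (inj₁ refl) (λ ()))
          m10-11 = resolve₂ (two c10 refl) (excludes m8-9 (inj₂ refl) (inj₁ refl) (λ ()))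
          m0-6 = resolve₂ (resolve₂ (three c0 refl) (excludes m10-11 (inj₂ refl) (inj₁ refl) (λ ()))) ¬m0-1
        at-c6 (inj₂ (inj₂ m0-6)) = external-state mtu mvt m1-2 m4-5 m7-8 m10-11 m0-6
          where
          m7-8 = resolve₂ (two c7 refl) (excludes m0-6 (inj₂ refl) (inj₁ refl) (λ ()))
          m10-11 = resolve₁ (two c11 refl) (excludes m0-6 (inj₁ refl) (inj₂ refl) (λ ()))
          mvt = resolve₂ (resolve₂ (three c9 refl) (excludes m7-8 (inj₂ refl) (inj₁ refl) (λ ())))
                         (excludes m10-11 (inj₁ refl) (inj₂ refl) (λ ()))

    data Summary (i : Fin 4) : State → Set where
      outside : tu i ∈ₑ M → vt i ∈ₑ M → Summary i external
      inside : ∀ b → ¬ tu i ∈ₑ M → ¬ vt i ∈ₑ M → Summary i (parity b)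

    cycle-summary : ∀ i → Σ State λ s → Summary i s × (∀ a → local i (cycleMate s a) ∈ₑ M)
    cycle-summary i = summarise (cycleState i)
      where
      summarise : CycleState i → Σ State λ s → Summary i s × (∀ a → local i (cycleMate s a) ∈ₑ M)
      summarise (external-state mtu mvt m1-2 m4-5 m7-8 m10-11 m0-6) = external , outside mtu mvt , mates
        where
        mates : ∀ a → local i (cycleMate external a) ∈ₑ M
        mates c0 = m0-6
        mates c1 = m1-2
        mates c2 = m1-2
        mates c3 = mtu
        mates c4 = m4-5
        mates c5 = m4-5
        mates c6 = m0-6
        mates c7 = m7-8
        mates c8 = m7-8
        mates c9 = mvt
        mates c10 = m10-11
        mates c11 = m10-11
      summarise (even-state ¬mtu ¬mvt m0-1 m2-3 m4-5 m6-7 m8-9 m10-11) = even , inside true ¬mtu ¬mvt , mates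
        where
        mates : ∀ a → local i (cycleMate even a) ∈ₑ M
        mates c0 = m0-1
        mates c1 = m0-1
        mates c2 = m2-3
        mates c3 = m2-3
        mates c4 = m4-5
        mates c5 = m4-5
        mates c6 = m6-7
        mates c7 = m6-7
        mates c8 = m8-9
        mates c9 = m8-9
        mates c10 = m10-11
        mates c11 = m10-11
      summarise (odd-state ¬mtu ¬mvt m1-2 m3-4 m5-6 m7-8 m9-10 m11-0) = odd , inside false ¬mtu ¬mvt , mates
        where
        mates : ∀ a → local i (cycleMate odd a) ∈ₑ M
        mates c0 = m11-0
        mates c1 = m1-2
        mates c2 = m1-2
        mates c3 = m3-4
        mates c4 = m3-4
        mates c5 = m5-6
        mates c6 = m5-6
        mates c7 = m7-8
        mates c8 = m7-8
        mates c9 = m9-10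
        mates c10 = m9-10
        mates c11 = m11-0

    top-matched : ∀ t → tu t ∈ₑ M ⊎ vt (previous t) ∈ₑ M
    top-matched t = at-t (matched (top t))
      where
      at-t : MatchedAt (top t) → tu t ∈ₑ M ⊎ vt (previous t) ∈ₑ M
      at-t (ed , ed∈ , isE , inc) = by-cases (incident-top isE inc) ed∈
        where
        by-cases : ∀ {ed} → ed ≡ tu t ⊎ ed ≡ vt (previous t) → ed ∈ₑ M → tu t ∈ₑ M ⊎ vt (previous t) ∈ₑ M
        by-cases (inj₁ refl) ed∈ = inj₁ ed∈
        by-cases (inj₂ refl) ed∈ = inj₂ ed∈

    not-neither : ∀ t → ¬ tu t ∈ₑ M → ¬ vt (previous t) ∈ₑ M → ⊥
    not-neither t ¬mtu ¬mvt = [ ¬mtu , ¬mvt ]′ (top-matched t)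

    not-both : ∀ t → tu t ∈ₑ M → vt (previous t) ∈ₑ M → ⊥
    not-both t mtu mvt = exclusive mtu mvt (λ ()) (inj₁ refl) (incident t)
      where
      incident : ∀ t → Incident (top t) (vt (previous t))
      incident fz = inj₂ refl
      incident (fs fz) = inj₂ refl
      incident (fs (fs fz)) = inj₂ refl
      incident (fs (fs (fs fz))) = inj₂ refl

    -- Around the outer cycle t_{i+1} is matched either to v_i or to u_{i+1}, so
    -- external and internal copies of H alternate.
    assemble : ∀ {s₀ s₁ s₂ s₃} → Summary (# 0) s₀ → Summary (# 1) s₁ → Summary (# 2) s₂ → Summary (# 3) s₃ →
      Σ Config λ c → (stateOf c (# 0) ≡ s₀ × stateOf c (# 1) ≡ s₁ × stateOf c (# 2) ≡ s₂ × stateOf c (# 3) ≡ s₃)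
                    × (∀ t → topMate (proj₁ c) t ∈ₑ M)
    assemble (inside b0 ¬mtu0 ¬mvt0) (inside b1 ¬mtu1 ¬mvt1) (inside b2 ¬mtu2 ¬mvt2) (inside b3 ¬mtu3 ¬mvt3) =
      ⊥-elim (not-neither (# 1) ¬mtu1 ¬mvt0)
    assemble (inside b0 ¬mtu0 ¬mvt0) (inside b1 ¬mtu1 ¬mvt1) (inside b2 ¬mtu2 ¬mvt2) (outside mtu3 mvt3) =
      ⊥-elim (not-neither (# 1) ¬mtu1 ¬mvt0)
    assemble (inside b0 ¬mtu0 ¬mvt0) (inside b1 ¬mtu1 ¬mvt1) (outside mtu2 mvt2) (inside b3 ¬mtu3 ¬mvt3) =
      ⊥-elim (not-neither (# 1) ¬mtu1 ¬mvt0)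
    assemble (inside b0 ¬mtu0 ¬mvt0) (inside b1 ¬mtu1 ¬mvt1) (outside mtu2 mvt2) (outside mtu3 mvt3) =
      ⊥-elim (not-neither (# 1) ¬mtu1 ¬mvt0)
    assemble (inside b0 ¬mtu0 ¬mvt0) (outside mtu1 mvt1) (inside b2 ¬mtu2 ¬mvt2) (inside b3 ¬mtu3 ¬mvt3) =
      ⊥-elim (not-neither (# 3) ¬mtu3 ¬mvt2)
    assemble (inside b0 ¬mtu0 ¬mvt0) (outside mtu1 mvt1) (inside b2 ¬mtu2 ¬mvt2) (outside mtu3 mvt3) =
      (false , b0 , b2) , (refl , refl , refl , refl) , λ { fz → mvt3 ; (fs fz) → mtu1 ; (fs (fs fz)) → mvt1 ; (fs (fs (fs fz))) → mtu3 }
    assemble (inside b0 ¬mtu0 ¬mvt0) (outside mtu1 mvt1) (outside mtu2 mvt2) (inside b3 ¬mtu3 ¬mvt3) =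
      ⊥-elim (not-both (# 2) mtu2 mvt1)
    assemble (inside b0 ¬mtu0 ¬mvt0) (outside mtu1 mvt1) (outside mtu2 mvt2) (outside mtu3 mvt3) =
      ⊥-elim (not-both (# 2) mtu2 mvt1)
    assemble (outside mtu0 mvt0) (inside b1 ¬mtu1 ¬mvt1) (inside b2 ¬mtu2 ¬mvt2) (inside b3 ¬mtu3 ¬mvt3) =
      ⊥-elim (not-neither (# 2) ¬mtu2 ¬mvt1)
    assemble (outside mtu0 mvt0) (inside b1 ¬mtu1 ¬mvt1) (inside b2 ¬mtu2 ¬mvt2) (outside mtu3 mvt3) =
      ⊥-elim (not-neither (# 2) ¬mtu2 ¬mvt1)
    assemble (outside mtu0 mvt0) (inside b1 ¬mtu1 ¬mvt1) (outside mtu2 mvt2) (inside b3 ¬mtu3 ¬mvt3) =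
      (true , b1 , b3) , (refl , refl , refl , refl) , λ { fz → mtu0 ; (fs fz) → mvt0 ; (fs (fs fz)) → mtu2 ; (fs (fs (fs fz))) → mvt2 }
    assemble (outside mtu0 mvt0) (inside b1 ¬mtu1 ¬mvt1) (outside mtu2 mvt2) (outside mtu3 mvt3) =
      ⊥-elim (not-both (# 3) mtu3 mvt2)
    assemble (outside mtu0 mvt0) (outside mtu1 mvt1) (inside b2 ¬mtu2 ¬mvt2) (inside b3 ¬mtu3 ¬mvt3) =
      ⊥-elim (not-both (# 1) mtu1 mvt0)
    assemble (outside mtu0 mvt0) (outside mtu1 mvt1) (inside b2 ¬mtu2 ¬mvt2) (outside mtu3 mvt3) =
      ⊥-elim (not-both (# 1) mtu1 mvt0)
    assemble (outside mtu0 mvt0) (outside mtu1 mvt1) (outside mtu2 mvt2) (inside b3 ¬mtu3 ¬mvt3) =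
      ⊥-elim (not-both (# 1) mtu1 mvt0)
    assemble (outside mtu0 mvt0) (outside mtu1 mvt1) (outside mtu2 mvt2) (outside mtu3 mvt3) =
      ⊥-elim (not-both (# 1) mtu1 mvt0)

    mates-∈ : Σ Config λ c → ∀ x → mate c x ∈ₑ M
    mates-∈ = from (assemble (summary (# 0)) (summary (# 1)) (summary (# 2)) (summary (# 3)))
      where
      σ : Fin 4 → State
      σ i = proj₁ (cycle-summary i)
      summary : ∀ i → Summary i (σ i)
      summary i = proj₁ (proj₂ (cycle-summary i))
      from : (Σ Config λ c → (stateOf c (# 0) ≡ σ (# 0) × stateOf c (# 1) ≡ σ (# 1) × stateOf c (# 2) ≡ σ (# 2) × stateOf c (# 3) ≡ σ (# 3))
                            × (∀ t → topMate (proj₁ c) t ∈ₑ M)) → Σ Config λ c → ∀ x → mate c x ∈ₑ M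
      from (c , (e₀ , e₁ , e₂ , e₃) , tops) = c , mates
        where
        states : ∀ i → stateOf c i ≡ σ i
        states fz = e₀
        states (fs fz) = e₁
        states (fs (fs fz)) = e₂
        states (fs (fs (fs fz))) = e₃
        mates : ∀ x → mate c x ∈ₑ M
        mates (top t) = tops t
        mates (cyc i a) = subst (λ s → local i (cycleMate s a) ∈ₑ M) (sym (states i)) (proj₂ (proj₂ (cycle-summary i)) a)
        mates (pathInt i r j) = Chain.Idle.pathE-odd-∈ i r (chain-idle i r) ⌊ toℕ j /2⌋ (⌊j/2⌋<k j)
        mates (boxA i r m) = Chain.Idle.boxMid-∈ i r (chain-idle i r) m
        mates (boxB i r m) = Chain.Idle.boxMid-∈ i r (chain-idle i r) m

    perfect⇒matchingOf : Σ Config λ c → M ≡ matchingOf c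
    perfect⇒matchingOf = c , perfect≡edgesOf {M} {mate c} (proj₁ pm) (proj₂ mates-∈) (λ x → proj₁ (mate-at c x))
      where c = proj₁ mates-∈

  bools : List Bool
  bools = true ∷ false ∷ []

  ∈-bools : ∀ b → b List.∈ bools
  ∈-bools true = here refl
  ∈-bools false = there (here refl)

  unique-bools : Unique bools
  unique-bools = ((λ ()) ∷ []) ∷ [] ∷ []

  parities : List (Bool × Bool)
  parities = cartesianProduct bools bools

  configs : List Config
  configs = cartesianProduct bools parities

  sided : Bool → List Config
  sided b = map (b ,_) parities

  perfect-matchings : HasExactly (IsPerfectMatching k) (length configs)
  perfect-matchings = hasExactly-image matchingOf matchingOf-injective
    (Unique.cartesianProduct⁺ unique-bools (Unique.cartesianProduct⁺ unique-bools unique-bools)) complete (λ _ → matchingOf-perfect _)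
    where
    complete : ∀ {M} → IsPerfectMatching k M → ∃[ c ] (c List.∈ configs × M ≡ matchingOf c)
    complete {M} pm = let ((b , p , q) , M≡) = Structure.perfect⇒matchingOf M pm in
      (b , p , q) , ∈-cartesianProduct⁺ (∈-bools b) (∈-cartesianProduct⁺ (∈-bools p) (∈-bools q)) , M≡

  OnSide : Bool → EdgeSet k → Set
  OnSide true M = IsPerfectMatching k M × S k (# 0) M × S k (# 2) M × ¬ S k (# 1) M × ¬ S k (# 3) M
  OnSide false M = IsPerfectMatching k M × S k (# 1) M × S k (# 3) M × ¬ S k (# 0) M × ¬ S k (# 2) M

  onSide-matchingOf : ∀ b p q → OnSide b (matchingOf (b , p , q))
  onSide-matchingOf true p q = matchingOf-perfect c , S-external c (# 0) refl , S-external c (# 2) refl ,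
    ¬S-parity c (# 1) p refl , ¬S-parity c (# 3) q refl
    where c = (true , p , q)
  onSide-matchingOf false p q = matchingOf-perfect c , S-external c (# 1) refl , S-external c (# 3) refl ,
    ¬S-parity c (# 0) p refl , ¬S-parity c (# 2) q refl
    where c = (false , p , q)

  onSide-perfect : ∀ b {M} → OnSide b M → IsPerfectMatching k M
  onSide-perfect true = proj₁
  onSide-perfect false = proj₁

  onSide-side : ∀ b c → OnSide b (matchingOf c) → proj₁ c ≡ b
  onSide-side true (true , _) _ = refl
  onSide-side true (false , p , q) (_ , S₀ , _) = ⊥-elim (¬S-parity (false , p , q) (# 0) p refl S₀)
  onSide-side false (true , p , q) (_ , S₁ , _) = ⊥-elim (¬S-parity (true , p , q) (# 1) p refl S₁)
  onSide-side false (false , _) _ = refl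

  onSide-matchings : ∀ b → HasExactly (OnSide b) (length (sided b))
  onSide-matchings b = hasExactly-image matchingOf matchingOf-injective
    (Unique.map⁺ {f = b ,_} (λ { refl → refl }) (Unique.cartesianProduct⁺ unique-bools unique-bools)) complete sound
    where
    complete : ∀ {M} → OnSide b M → ∃[ c ] (c List.∈ sided b × M ≡ matchingOf c)
    complete {M} side = let (c , M≡) = Structure.perfect⇒matchingOf M (onSide-perfect b side) in
      c , ∈-sided c (onSide-side b c (subst (OnSide b) M≡ side)) , M≡
      where
      ∈-sided : ∀ c → proj₁ c ≡ b → c List.∈ sided b
      ∈-sided (_ , p , q) refl = ∈-map⁺ (b ,_) (∈-cartesianProduct⁺ (∈-bools p) (∈-bools q))
    sound : ∀ {c} → c List.∈ sided b → OnSide b (matchingOf c)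
    sound c∈ = let ((p , q) , _ , c≡) = ∈-map⁻ (b ,_) c∈ in subst (λ c → OnSide b (matchingOf c)) (sym c≡) (onSide-matchingOf b p q)

lemma2 : (k : ℕ) → 1 ≤ k →
    HasExactly (IsPerfectMatching k) 8
    × HasExactly (λ M → IsPerfectMatching k M
                   × S k (# 0) M × S k (# 2) M × ¬ S k (# 1) M × ¬ S k (# 3) M) 4
    × HasExactly (λ M → IsPerfectMatching k M
                   × S k (# 1) M × S k (# 3) M × ¬ S k (# 0) M × ¬ S k (# 2) M) 4
lemma2 (suc k') _ = perfect-matchings , onSide-matchings true , onSide-matchings false
  where open Counterexample k'
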